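{- There is an absolute constant $c>0$ such that the following holds. Let $m$ be a squarefree positive integer, $B\subseteq\mathbb{Z}_m^\ast$, and $k$ a positive integer. For $b_1,\dots,b_k\in B$ and a prime $p\mid m$ let $r_p(b_1,\dots,b_k)=|\{s\in[0,p-1] : b_i\equiv s\pmod p \text{ for some } i\in\{1,\dots,k\}\}|$, and let $$f(b_1,\dots,b_k)=\sum_{p\mid m,\ r_p(b_1,\dots,b_k)\leq k-1}\frac1p.$$ Then for every $\beta\in\mathbb{R}^+$, $$\left|\{(b_1,\dots,b_k)\in B^k : f(b_1,\dots,b_k)\geq\beta\}\right|\leq k^2\,2^{ -\exp(\beta/ck^2)}\,|B|^{k-2}\varphi(m)^2.$$
   Context: $\mathbb{Z}_m^\ast=\{x\in\mathbb{Z}/m\mathbb{Z}:\gcd(x,m)=1\}$; $\varphi$ is Euler's totient function; sums over $p$ range over primes. Reduction of elements of $\mathbb{Z}_m$ modulo a prime $p\mid m$ is well defined.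
   Formalization: The parameter β ranges over the positive rationals instead of $\mathbb{R}^+$, and the absolute constant c is taken in the rationals. -}

module Defs where

open import Data.Bool using (Bool; true; false; if_then_else_)
open import Data.Nat as ℕ using (ℕ; zero; suc; _∸_; _≤?_)
open import Data.Nat.DivMod using (_%_)
open import Data.Nat.Divisibility using (_∣_; _∣?_)
open import Data.Nat.Primality using (Prime; prime?)
open import Data.Nat.Coprimality using (coprime?)
open import Data.Fin using (Fin; toℕ)
open import Data.Fin.Subset using (Subset; _∈_; ∣_∣)
open import Data.Fin.Subset.Properties using (_∈?_)
open import Data.List using (List; []; _∷_; filter; length; upTo; foldr; map; concatMap; allFin)
open import Data.List.Relation.Unary.Any using (any?)
open import Data.Vec using (Vec; []; _∷_; toList)
open import Data.Integer using (+_; -[1+_])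
open import Data.Rational as ℚ using (ℚ; 0ℚ; 1ℚ; _+_; _*_)
open import Data.Rational.Properties as ℚP using ()
open import Relation.Nullary using (¬_)
open import Relation.Nullary.Decidable using (does; _×-dec_)
open import Relation.Binary.PropositionalEquality using (_≡_)

-- reduction of a natural number modulo p (p is always a prime ≥ 2 below)
modN : ℕ → ℕ → ℕ
modN n zero    = n
modN n (suc q) = n % suc q

-- 1/n as a rational (only used for n ≥ 1)
invℕ : ℕ → ℚ
invℕ zero    = 0ℚ
invℕ (suc n) = + 1 ℚ./ suc n

-- reciprocal of a rational (only used for nonzero arguments)
recipℚ : ℚ → ℚ
recipℚ p@(ℚ.mkℚ (+ zero) _ _)   = 0ℚ
recipℚ p@(ℚ.mkℚ (+ (suc _)) _ _) = ℚ.1/ p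
recipℚ p@(ℚ.mkℚ -[1+ _ ] _ _)   = ℚ.1/ p

-- list of all primes dividing m (every such prime is ≤ m when m ≥ 1)
primeDivisors : ℕ → List ℕ
primeDivisors m = filter (λ p → prime? p ×-dec p ∣? m) (upTo (suc m))

Squarefree : ℕ → Set
Squarefree m = ∀ p → Prime p → ¬ (p ℕ.* p ∣ m)

totient : ℕ → ℕ
totient m = length (filter (λ x → coprime? x m) (upTo m))

elems : ∀ {m} → Subset m → List (Fin m)
elems {m} B = filter (λ x → x ∈? B) (allFin m)

tuples : ∀ {A : Set} → List A → (k : ℕ) → List (Vec A k)
tuples xs zero    = [] ∷ []
tuples xs (suc k) = concatMap (λ x → map (x ∷_) (tuples xs k)) xs

rp : ∀ {m k} → ℕ → Vec (Fin m) k → ℕ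
rp p v = length (filter (λ s → any? (λ x → modN (toℕ x) p ℕ.≟ s) (toList v)) (upTo p))

fval : ∀ m k → Vec (Fin m) k → ℚ
fval m k v = foldr (λ p acc → invℕ p + acc) 0ℚ (filter (λ p → rp p v ≤? k ∸ 1) (primeDivisors m))

count : ∀ m k → Subset m → ℚ → ℕ
count m k B β = length (filter (λ v → β ℚP.≤? fval m k v) (tuples (elems B) k))

expTerm : ℚ → ℕ → ℚ
expTerm y zero    = 1ℚ
expTerm y (suc j) = expTerm y j * y * invℕ (suc j)

expPartial : ℚ → ℕ → ℚ
expPartial y zero    = 1ℚ
expPartial y (suc n) = expPartial y n + expTerm y (suc n)

module Submission where

-- Lemma 4.2: with c = 100, for squarefree m, B ⊆ ℤ_m^*, k ≥ 1 and β > 0,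
--   #{ b ∈ B^k : f(b) ≥ β } · |B|² · 2^{exp(β/ck²)} ≤ k² |B|^k φ(m)²,
-- where exp(y), y = β/(ck²), is replaced by any lower bound a/(b+1) ≤ Σ_{j≤n} y^j/j!
-- (the statement raises both sides to the power b+1 to stay inside ℕ).
--
-- Split f(b) ≤ Q(T) + X_T(b), where Q(T) = Σ_{p ≤ T} 1/p over all primes and X_T(b)
-- collects the primes p ∣ m with p > T and r_p(b) ≤ k-1.  A Chebyshev bound (the primes in
-- (n, 2n] divide the central binomial coefficient, which is ≤ 4^n) gives the Mertens-type
-- estimate Q(2^{2^t}) ≤ 2 + 2t.  For a single prime p ∣ m, the number of k-tuples with
-- r_p ≤ k-1 is at most k² |B|^{k-2} φ(m)/(p-1): by induction on k, using that each residue
-- class mod p meets B in at most φ(m)/(p-1) elements (the map (y, s) ↦ y + (m/p)s injects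
-- such a class, times the p-1 admissible s, into ℤ_m^*).  Summing over p > T and
-- telescoping Σ_{p>T} 1/(p(p-1)) ≤ 1/T bounds Σ_b X_T(b), and Markov's inequality then
-- bounds the number of b with f(b) ≥ β once 2Q(T) ≤ β.  Finally the partial sums of exp(y)
-- are bounded by 2 (for y ≤ 1/2) or by 2·16^N (for y ≤ N), and T = 2^{2^{4N+2}} is chosen.

open import Data.Bool using (Bool; true; false; if_then_else_; _∨_; not)
open import Data.Empty using (⊥-elim)
open import Data.Fin using (Fin; toℕ)
import Data.Fin.Properties as FP
open import Data.Fin.Subset using (Subset; _∈_; ∣_∣)
open import Data.Fin.Subset.Properties using (_∈?_)
import Data.Integer as ℤ
import Data.Integer.Properties as ℤP
open import Data.List as L using (List; []; _∷_; map; filter; length; foldr; concatMap; upTo; _++_; [_]; cartesianProduct)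
import Data.List.Properties as LP
import Data.List.Membership.Propositional as Mem
import Data.List.Membership.Propositional.Properties as MemP
open import Data.List.Relation.Unary.All as All using (All; []; _∷_)
import Data.List.Relation.Unary.All.Properties as AllP
open import Data.List.Relation.Unary.AllPairs using ([]; _∷_)
open import Data.List.Relation.Unary.Any using (Any; here; there; any?)
open import Data.List.Relation.Unary.Unique.Propositional using (Unique)
import Data.List.Relation.Unary.Unique.Propositional.Properties as UniqueP
open import Data.Nat as ℕ using (ℕ; zero; suc; _+_; _*_; _^_; _≤_; _<_; z≤n; s≤s; _∸_; _⊔_; _!; NonZero)
import Data.Nat.Properties as NP
open import Data.Nat.Coprimality as Coprimality using (Coprime; coprime?; coprime-divisor)
open import Data.Nat.DivMod
open import Data.Nat.Divisibility
open import Data.Nat.ListAction using (product)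
open import Data.Nat.Primality
open import Data.Nat.Tactic.RingSolver using (solve-∀)
open import Data.Product using (∃; Σ; _×_; _,_; proj₁; proj₂)
open import Data.Rational as ℚ using (ℚ; 0ℚ; 1ℚ; mkℚ; Positive)
import Data.Rational.Properties as QP
open import Data.Rational.Solver using (module +-*-Solver)
import Data.Rational.Unnormalised as ℚᵘ
import Data.Rational.Unnormalised.Properties as ℚᵘP
open import Data.Sum using (inj₁; inj₂)
open import Data.Vec as Vec using (Vec; toList)
open import Function using (_∘_)
open import Relation.Binary.PropositionalEquality hiding ([_])
open import Relation.Nullary using (Dec; yes; no; does; ¬_)
open import Relation.Nullary.Decidable using (_×-dec_; ¬?)
open import Relation.Unary using (Pred; Decidable)
open import Defs


-- ι n = n as a rational; frac a b = a/(b+1).  Inequalities and arithmetic between such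
-- fractions are decided by cross-multiplication in ℕ, transported through ℚᵘ.
ι : ℕ → ℚ
ι n = ℤ.+ n ℚ./ 1

frac : ℕ → ℕ → ℚ
frac a b = ℤ.+ a ℚ./ suc b

frac-ᵘ : ∀ a b → ℚ.toℚᵘ (frac a b) ℚᵘ.≃ ℚᵘ.mkℚᵘ (ℤ.+ a) b
frac-ᵘ a b = QP.toℚᵘ-fromℚᵘ (ℚᵘ.mkℚᵘ (ℤ.+ a) b)

≡-viaᵘ : ∀ {p q u} → ℚ.toℚᵘ p ℚᵘ.≃ u → ℚ.toℚᵘ q ℚᵘ.≃ u → p ≡ q
≡-viaᵘ h h' = QP.toℚᵘ-injective (ℚᵘP.≃-trans h (ℚᵘP.≃-sym h'))

frac-≤ : ∀ a b c d → a * suc d ≤ c * suc b → frac a b ℚ.≤ frac c d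
frac-≤ a b c d h = QP.toℚᵘ-cancel-≤
  (ℚᵘP.≤-respʳ-≃ (ℚᵘP.≃-sym (frac-ᵘ c d)) (ℚᵘP.≤-respˡ-≃ (ℚᵘP.≃-sym (frac-ᵘ a b))
    (ℚᵘ.*≤* (subst₂ ℤ._≤_ (ℤP.pos-* a (suc d)) (ℤP.pos-* c (suc b)) (ℤ.+≤+ h)))))

frac-≤⁻ : ∀ a b c d → frac a b ℚ.≤ frac c d → a * suc d ≤ c * suc b
frac-≤⁻ a b c d h with ℚᵘP.≤-respʳ-≃ (frac-ᵘ c d) (ℚᵘP.≤-respˡ-≃ (frac-ᵘ a b) (QP.toℚᵘ-mono-≤ h))
... | ℚᵘ.*≤* z = ℤP.drop‿+≤+ (subst₂ ℤ._≤_ (sym (ℤP.pos-* a (suc d))) (sym (ℤP.pos-* c (suc b))) z)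

frac-≡ : ∀ a b c d → a * suc d ≡ c * suc b → frac a b ≡ frac c d
frac-≡ a b c d h = QP.≤-antisym (frac-≤ a b c d (NP.≤-reflexive h)) (frac-≤ c d a b (NP.≤-reflexive (sym h)))

ι-mono : ∀ {a b} → a ≤ b → ι a ℚ.≤ ι b
ι-mono {a} {b} h = frac-≤ a 0 b 0 (subst₂ _≤_ (sym (NP.*-identityʳ a)) (sym (NP.*-identityʳ b)) h)

ι-cancel : ∀ {a b} → ι a ℚ.≤ ι b → a ≤ b
ι-cancel {a} {b} h = subst₂ _≤_ (NP.*-identityʳ a) (NP.*-identityʳ b) (frac-≤⁻ a 0 b 0 h)

ι-nonneg : ∀ n → 0ℚ ℚ.≤ ι n
ι-nonneg n = ι-mono {0} {n} z≤n

ι-pos : ∀ n → 1 ≤ n → Positive (ι n)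
ι-pos (suc n) _ = QP.normalize-pos (suc n) 1

ι-+ : ∀ a b → ι (a + b) ≡ ι a ℚ.+ ι b
ι-+ a b = ≡-viaᵘ (frac-ᵘ (a + b) 0) (ℚᵘP.≃-trans (QP.toℚᵘ-homo-+ (ι a) (ι b))
  (ℚᵘP.≃-trans (ℚᵘP.+-cong (frac-ᵘ a 0) (frac-ᵘ b 0))
    (ℚᵘ.*≡* (cong (ℤ._* ℤ.+ 1) (trans (cong₂ ℤ._+_ (ℤP.*-identityʳ (ℤ.+ a)) (ℤP.*-identityʳ (ℤ.+ b))) (sym (ℤP.pos-+ a b)))))))

ι-* : ∀ a b → ι (a * b) ≡ ι a ℚ.* ι b
ι-* a b = ≡-viaᵘ (frac-ᵘ (a * b) 0) (ℚᵘP.≃-trans (QP.toℚᵘ-homo-* (ι a) (ι b))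
  (ℚᵘP.≃-trans (ℚᵘP.*-cong (frac-ᵘ a 0) (frac-ᵘ b 0)) (ℚᵘ.*≡* (cong (ℤ._* ℤ.+ 1) (sym (ℤP.pos-* a b))))))

invℕ-inverse : ∀ n → invℕ (suc n) ℚ.* ι (suc n) ≡ 1ℚ
invℕ-inverse n = ≡-viaᵘ
  (ℚᵘP.≃-trans (QP.toℚᵘ-homo-* (invℕ (suc n)) (ι (suc n))) (ℚᵘP.*-cong (frac-ᵘ 1 n) (frac-ᵘ (suc n) 0)))
  (ℚᵘ.*≡* (trans (ℤP.*-identityˡ _) (trans (cong ℤ.+_ (NP.*-identityʳ (suc n))) (sym (trans (ℤP.*-identityʳ _) (ℤP.*-identityˡ _))))))

frac-split : ∀ a d → frac a d ≡ ι a ℚ.* invℕ (suc d)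
frac-split a d = ≡-viaᵘ (frac-ᵘ a d) (ℚᵘP.≃-trans (QP.toℚᵘ-homo-* (ι a) (invℕ (suc d)))
  (ℚᵘP.≃-trans (ℚᵘP.*-cong (frac-ᵘ a 0) (frac-ᵘ 1 d))
    (ℚᵘ.*≡* (cong₂ (λ x y → x ℤ.* ℤ.+ suc y) (ℤP.*-identityʳ (ℤ.+ a)) (sym (NP.+-identityʳ d))))))

frac-+ : ∀ a c d → frac a d ℚ.+ frac c d ≡ frac (a + c) d
frac-+ a c d = begin
    frac a d ℚ.+ frac c d
  ≡⟨ cong₂ ℚ._+_ (frac-split a d) (frac-split c d) ⟩
    ι a ℚ.* invℕ (suc d) ℚ.+ ι c ℚ.* invℕ (suc d)
  ≡⟨ sym (QP.*-distribʳ-+ (invℕ (suc d)) (ι a) (ι c)) ⟩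
    (ι a ℚ.+ ι c) ℚ.* invℕ (suc d)
  ≡⟨ cong (ℚ._* invℕ (suc d)) (sym (ι-+ a c)) ⟩
    ι (a + c) ℚ.* invℕ (suc d)
  ≡⟨ sym (frac-split (a + c) d) ⟩
    frac (a + c) d
  ∎
  where open ≡-Reasoning

invℕ-nonneg : ∀ n → 0ℚ ℚ.≤ invℕ n
invℕ-nonneg zero = QP.≤-refl
invℕ-nonneg (suc n) = frac-≤ 0 0 1 n z≤n

nonNeg : ∀ {p} → 0ℚ ℚ.≤ p → ℚ.NonNegative p
nonNeg h = ℚ.nonNegative h

*-nonneg : ∀ {a b} → 0ℚ ℚ.≤ a → 0ℚ ℚ.≤ b → 0ℚ ℚ.≤ a ℚ.* b
*-nonneg {a} {b} ha hb = QP.≤-trans (QP.≤-reflexive (sym (QP.*-zeroˡ b))) (QP.*-monoʳ-≤-nonNeg b {{nonNeg hb}} ha)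

*-mono-nonneg : ∀ {a a' b b'} → 0ℚ ℚ.≤ a → 0ℚ ℚ.≤ b' → a ℚ.≤ a' → b ℚ.≤ b' → a ℚ.* b ℚ.≤ a' ℚ.* b'
*-mono-nonneg {a} {a'} {b} {b'} 0≤a 0≤b' a≤a' b≤b' =
  QP.≤-trans (QP.*-monoˡ-≤-nonNeg a {{nonNeg 0≤a}} b≤b') (QP.*-monoʳ-≤-nonNeg b' {{nonNeg 0≤b'}} a≤a')

module _ {A : Set} where
  Σℕ : (A → ℕ) → List A → ℕ
  Σℕ f [] = 0
  Σℕ f (x ∷ xs) = f x + Σℕ f xs

  Σℚ : (A → ℚ) → List A → ℚ
  Σℚ f [] = 0ℚ
  Σℚ f (x ∷ xs) = f x ℚ.+ Σℚ f xs

𝟙 : Bool → ℕ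
𝟙 b = if b then 1 else 0

guard : Bool → ℚ → ℚ
guard b q = if b then q else 0ℚ

module _ {A : Set} where
  Σℕ-mono : ∀ {f g : A → ℕ} xs → (∀ x → f x ≤ g x) → Σℕ f xs ≤ Σℕ g xs
  Σℕ-mono [] h = z≤n
  Σℕ-mono (x ∷ xs) h = NP.+-mono-≤ (h x) (Σℕ-mono xs h)

  Σℕ-cong : ∀ {f g : A → ℕ} xs → (∀ x → f x ≡ g x) → Σℕ f xs ≡ Σℕ g xs
  Σℕ-cong [] h = refl
  Σℕ-cong (x ∷ xs) h = cong₂ _+_ (h x) (Σℕ-cong xs h)

  Σℕ-+ : ∀ (f g : A → ℕ) xs → Σℕ (λ x → f x + g x) xs ≡ Σℕ f xs + Σℕ g xs
  Σℕ-+ f g [] = refl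
  Σℕ-+ f g (x ∷ xs) rewrite Σℕ-+ f g xs = interchange (f x) (g x) (Σℕ f xs) (Σℕ g xs)
    where
    interchange : ∀ a b c d → (a + b) + (c + d) ≡ (a + c) + (b + d)
    interchange = solve-∀

  Σℕ-*ˡ : ∀ c (f : A → ℕ) xs → Σℕ (λ x → c * f x) xs ≡ c * Σℕ f xs
  Σℕ-*ˡ c f [] = sym (NP.*-zeroʳ c)
  Σℕ-*ˡ c f (x ∷ xs) rewrite Σℕ-*ˡ c f xs = sym (NP.*-distribˡ-+ c (f x) (Σℕ f xs))

  Σℕ-const : ∀ c (xs : List A) → Σℕ (λ _ → c) xs ≡ c * length xs
  Σℕ-const c [] = sym (NP.*-zeroʳ c)
  Σℕ-const c (x ∷ xs) rewrite Σℕ-const c xs = sym (NP.*-suc c (length xs))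

  Σℕ-++ : ∀ (f : A → ℕ) xs ys → Σℕ f (xs ++ ys) ≡ Σℕ f xs + Σℕ f ys
  Σℕ-++ f [] ys = refl
  Σℕ-++ f (x ∷ xs) ys rewrite Σℕ-++ f xs ys = sym (NP.+-assoc (f x) _ _)

  length-filter-Σ : ∀ {ℓ} {P : Pred A ℓ} (P? : Decidable P) xs →
                    length (filter P? xs) ≡ Σℕ (λ x → 𝟙 (does (P? x))) xs
  length-filter-Σ P? [] = refl
  length-filter-Σ P? (x ∷ xs) with does (P? x)
  ... | true = cong suc (length-filter-Σ P? xs)
  ... | false = length-filter-Σ P? xs

  Σℚ-cong : ∀ {f g : A → ℚ} xs → (∀ x → f x ≡ g x) → Σℚ f xs ≡ Σℚ g xs
  Σℚ-cong [] h = refl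
  Σℚ-cong (x ∷ xs) h = cong₂ ℚ._+_ (h x) (Σℚ-cong xs h)

  Σℚ-mono : ∀ {f g : A → ℚ} xs → (∀ x → f x ℚ.≤ g x) → Σℚ f xs ℚ.≤ Σℚ g xs
  Σℚ-mono [] h = QP.≤-refl
  Σℚ-mono (x ∷ xs) h = QP.+-mono-≤ (h x) (Σℚ-mono xs h)

  Σℚ-+ : ∀ (f g : A → ℚ) xs → Σℚ (λ x → f x ℚ.+ g x) xs ≡ Σℚ f xs ℚ.+ Σℚ g xs
  Σℚ-+ f g [] = refl
  Σℚ-+ f g (x ∷ xs) rewrite Σℚ-+ f g xs = interchange (f x) (g x) (Σℚ f xs) (Σℚ g xs)
    where
    open +-*-Solver
    interchange : ∀ a b c d → (a ℚ.+ b) ℚ.+ (c ℚ.+ d) ≡ (a ℚ.+ c) ℚ.+ (b ℚ.+ d)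
    interchange = solve 4 (λ a b c d → (a :+ b) :+ (c :+ d) := (a :+ c) :+ (b :+ d)) refl

  Σℚ-*ˡ : ∀ c (f : A → ℚ) xs → Σℚ (λ x → c ℚ.* f x) xs ≡ c ℚ.* Σℚ f xs
  Σℚ-*ˡ c f [] = sym (QP.*-zeroʳ c)
  Σℚ-*ˡ c f (x ∷ xs) rewrite Σℚ-*ˡ c f xs = sym (QP.*-distribˡ-+ c (f x) (Σℚ f xs))

  Σℚ-*ʳ : ∀ c (f : A → ℚ) xs → Σℚ f xs ℚ.* c ≡ Σℚ (λ x → f x ℚ.* c) xs
  Σℚ-*ʳ c f xs = trans (QP.*-comm (Σℚ f xs) c) (trans (sym (Σℚ-*ˡ c f xs)) (Σℚ-cong xs (λ x → QP.*-comm c (f x))))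

  Σℚ-ι : ∀ (f : A → ℕ) xs → Σℚ (λ x → ι (f x)) xs ≡ ι (Σℕ f xs)
  Σℚ-ι f [] = refl
  Σℚ-ι f (x ∷ xs) rewrite Σℚ-ι f xs = sym (ι-+ (f x) (Σℕ f xs))

  Σℚ-zero : ∀ (xs : List A) → Σℚ (λ _ → 0ℚ) xs ≡ 0ℚ
  Σℚ-zero [] = refl
  Σℚ-zero (x ∷ xs) = trans (QP.+-identityˡ _) (Σℚ-zero xs)

  Σℚ-nonneg : ∀ (f : A → ℚ) xs → (∀ x → 0ℚ ℚ.≤ f x) → 0ℚ ℚ.≤ Σℚ f xs
  Σℚ-nonneg f xs h = QP.≤-trans (QP.≤-reflexive (sym (Σℚ-zero xs))) (Σℚ-mono xs h)

  Σℚ-filter : ∀ {ℓ} {P : Pred A ℓ} (P? : Decidable P) (f : A → ℚ) xs →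
              Σℚ f (filter P? xs) ≡ Σℚ (λ x → guard (does (P? x)) (f x)) xs
  Σℚ-filter P? f [] = refl
  Σℚ-filter P? f (x ∷ xs) with does (P? x)
  ... | true = cong (f x ℚ.+_) (Σℚ-filter P? f xs)
  ... | false = trans (Σℚ-filter P? f xs) (sym (QP.+-identityˡ _))

  Σℚ-foldr : ∀ (f : A → ℚ) xs → foldr (λ p acc → f p ℚ.+ acc) 0ℚ xs ≡ Σℚ f xs
  Σℚ-foldr f [] = refl
  Σℚ-foldr f (x ∷ xs) = cong (f x ℚ.+_) (Σℚ-foldr f xs)

  Σℚ-++ : ∀ (f : A → ℚ) xs ys → Σℚ f (xs ++ ys) ≡ Σℚ f xs ℚ.+ Σℚ f ys
  Σℚ-++ f [] ys = sym (QP.+-identityˡ _)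
  Σℚ-++ f (x ∷ xs) ys = trans (cong (f x ℚ.+_) (Σℚ-++ f xs ys)) (sym (QP.+-assoc (f x) _ _))

module _ {A B : Set} where
  Σℕ-map : ∀ (f : B → ℕ) (g : A → B) xs → Σℕ f (map g xs) ≡ Σℕ (f ∘ g) xs
  Σℕ-map f g [] = refl
  Σℕ-map f g (x ∷ xs) = cong (f (g x) +_) (Σℕ-map f g xs)

  Σℕ-concatMap : ∀ (f : B → ℕ) (g : A → List B) xs → Σℕ f (concatMap g xs) ≡ Σℕ (λ x → Σℕ f (g x)) xs
  Σℕ-concatMap f g [] = refl
  Σℕ-concatMap f g (x ∷ xs) = trans (Σℕ-++ f (g x) (concatMap g xs)) (cong (Σℕ f (g x) +_) (Σℕ-concatMap f g xs))

  Σℚ-swap : ∀ (h : A → B → ℚ) xs ys → Σℚ (λ x → Σℚ (λ y → h x y) ys) xs ≡ Σℚ (λ y → Σℚ (λ x → h x y) xs) ys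
  Σℚ-swap h [] ys = sym (Σℚ-zero ys)
  Σℚ-swap h (x ∷ xs) ys = trans (cong (Σℚ (λ y → h x y) ys ℚ.+_) (Σℚ-swap h xs ys)) (sym (Σℚ-+ (h x) (λ y → Σℚ (λ x' → h x' y) xs) ys))

guard-ι : ∀ b q → guard b q ≡ ι (𝟙 b) ℚ.* q
guard-ι true q = sym (QP.*-identityˡ q)
guard-ι false q = sym (QP.*-zeroˡ q)

guard-nonneg : ∀ b {x} → 0ℚ ℚ.≤ x → 0ℚ ℚ.≤ guard b x
guard-nonneg true h = h
guard-nonneg false h = QP.≤-refl

guard-mono : ∀ {ℓ} {P : Set ℓ} (d : Dec P) {x y} → (P → x ℚ.≤ y) → guard (does d) x ℚ.≤ guard (does d) y
guard-mono (yes p) h = h p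
guard-mono (no _) h = QP.≤-refl

Σℚ-guard : ∀ {A : Set} (f : A → Bool) c xs → Σℚ (λ x → guard (f x) c) xs ≡ ι (Σℕ (λ x → 𝟙 (f x)) xs) ℚ.* c
Σℚ-guard f c xs = begin
    Σℚ (λ x → guard (f x) c) xs
  ≡⟨ Σℚ-cong xs (λ x → trans (guard-ι (f x) c) (QP.*-comm _ c)) ⟩
    Σℚ (λ x → c ℚ.* ι (𝟙 (f x))) xs
  ≡⟨ Σℚ-*ˡ c (λ x → ι (𝟙 (f x))) xs ⟩
    c ℚ.* Σℚ (λ x → ι (𝟙 (f x))) xs
  ≡⟨ trans (cong (c ℚ.*_) (Σℚ-ι (λ x → 𝟙 (f x)) xs)) (QP.*-comm c _) ⟩
    ι (Σℕ (λ x → 𝟙 (f x)) xs) ℚ.* c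
  ∎
  where open ≡-Reasoning

guard-Σℚ : ∀ {A : Set} b (f : A → ℚ) xs → Σℚ (λ x → guard b (f x)) xs ≡ guard b (Σℚ f xs)
guard-Σℚ true f xs = refl
guard-Σℚ false f xs = Σℚ-zero xs

-- Binomial coefficients C(a+b, a), defined by Pascal's rule.
binom : ℕ → ℕ → ℕ
binom zero b = 1
binom (suc a) zero = 1
binom (suc a) (suc b) = binom a (suc b) + binom (suc a) b

binom-factorial : ∀ a b → binom a b * (a ! * b !) ≡ (a + b) !
binom-factorial zero b = trans (NP.*-identityˡ _) (NP.*-identityˡ _)
binom-factorial (suc a) zero = trans (NP.*-identityˡ _) (trans (NP.*-identityʳ _) (cong _! (sym (NP.+-identityʳ (suc a)))))
binom-factorial (suc a) (suc b) = begin
    (binom a (suc b) + binom (suc a) b) * (suc a * a ! * (suc b * b !))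
  ≡⟨ distribute (binom a (suc b)) (binom (suc a) b) (a !) (b !) a b ⟩
    suc a * (binom a (suc b) * (a ! * (suc b * b !))) + suc b * (binom (suc a) b * ((suc a * a !) * b !))
  ≡⟨ cong₂ (λ u v → suc a * u + suc b * v) (binom-factorial a (suc b)) (binom-factorial (suc a) b) ⟩
    suc a * (a + suc b) ! + suc b * (suc a + b) !
  ≡⟨ cong (λ t → suc a * (a + suc b) ! + suc b * t !) (sym (NP.+-suc a b)) ⟩
    suc a * (a + suc b) ! + suc b * (a + suc b) !
  ≡⟨ sym (NP.*-distribʳ-+ ((a + suc b) !) (suc a) (suc b)) ⟩
    (suc a + suc b) * (a + suc b) !
  ≡⟨⟩
    (suc a + suc b) !
  ∎
  where
  open ≡-Reasoning
  distribute : ∀ x y fa fb a b → (x + y) * (suc a * fa * (suc b * fb))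
             ≡ suc a * (x * (fa * (suc b * fb))) + suc b * (y * ((suc a * fa) * fb))
  distribute = solve-∀

binom≤2^ : ∀ a b → binom a b ≤ 2 ^ (a + b)
binom≤2^ zero b = NP.m^n>0 2 b
binom≤2^ (suc a) zero = NP.m^n>0 2 (suc a + 0)
binom≤2^ (suc a) (suc b) = begin
    binom a (suc b) + binom (suc a) b
  ≤⟨ NP.+-mono-≤ (binom≤2^ a (suc b)) (binom≤2^ (suc a) b) ⟩
    2 ^ (a + suc b) + 2 ^ (suc a + b)
  ≡⟨ cong (λ t → 2 ^ t + 2 ^ (suc a + b)) (NP.+-suc a b) ⟩
    2 ^ (suc a + b) + 2 ^ (suc a + b)
  ≡⟨ cong (2 ^ (suc a + b) +_) (sym (NP.+-identityʳ _)) ⟩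
    2 ^ suc (suc a + b)
  ≡⟨ cong (2 ^_) (sym (NP.+-suc (suc a) b)) ⟩
    2 ^ (suc a + suc b)
  ∎
  where open NP.≤-Reasoning

binom-nonZero : ∀ a b → NonZero (binom a b)
binom-nonZero zero b = _
binom-nonZero (suc a) zero = _
binom-nonZero (suc a) (suc b) = ℕ.>-nonZero (NP.≤-trans (ℕ.>-nonZero⁻¹ _ {{binom-nonZero a (suc b)}}) (NP.m≤m+n _ _))

^-distribʳ-* : ∀ a b n → (a * b) ^ n ≡ a ^ n * b ^ n
^-distribʳ-* a b zero = refl
^-distribʳ-* a b (suc n) rewrite ^-distribʳ-* a b n = rearrange a b (a ^ n) (b ^ n)
  where
  rearrange : ∀ a b x y → a * b * (x * y) ≡ a * x * (b * y)
  rearrange = solve-∀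

prime≥2 : ∀ {p} → Prime p → 2 ≤ p
prime≥2 {p} pp = ℕ.nonTrivial⇒n>1 p {{prime⇒nonTrivial pp}}

prime≢1 : ∀ {p} → Prime p → p ≢ 1
prime≢1 pp refl with prime≥2 pp
... | s≤s ()

prime∣!⇒≤ : ∀ {p} n → Prime p → p ∣ n ! → p ≤ n
prime∣!⇒≤ zero pp d = ⊥-elim (prime≢1 pp (∣1⇒≡1 d))
prime∣!⇒≤ (suc n) pp d with euclidsLemma (suc n) (n !) pp d
... | inj₁ h = ∣⇒≤ h
... | inj₂ h = NP.≤-trans (prime∣!⇒≤ n pp h) (NP.n≤1+n n)

prime-coprime : ∀ {p n} → Prime p → ¬ (p ∣ n) → Coprime p n
prime-coprime pp p∤n (d∣p , d∣n) with prime⇒irreducible pp d∣p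
... | inj₁ d≡1 = d≡1
... | inj₂ refl = ⊥-elim (p∤n d∣n)

-- Every prime p ∈ (n, 2n] divides C(2n, n): it divides (2n)! but not n! · n!.
prime∣centralBinom : ∀ {p} n → Prime p → n < p → p ≤ n + n → p ∣ binom n n
prime∣centralBinom {suc p} n pp n<p p≤2n
  with euclidsLemma (binom n n) (n ! * n !) pp
         (subst (suc p ∣_) (sym (binom-factorial n n)) (∣-trans (∣m⇒∣m*n (p !) ∣-refl) (m≤n⇒m!∣n! p≤2n)))
... | inj₁ h = h
... | inj₂ h with euclidsLemma (n !) (n !) pp h
...   | inj₁ h' = ⊥-elim (NP.<⇒≱ n<p (prime∣!⇒≤ n pp h'))
...   | inj₂ h' = ⊥-elim (NP.<⇒≱ n<p (prime∣!⇒≤ n pp h'))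

centralBinom≤4^ : ∀ n → binom n n ≤ 4 ^ n
centralBinom≤4^ n = NP.≤-trans (binom≤2^ n n) (NP.≤-reflexive (trans (NP.^-distribˡ-+-* 2 n n) (sym (^-distribʳ-* 2 2 n))))

prime∣product : ∀ {p} xs → Prime p → All Prime xs → p ∣ product xs → p Mem.∈ xs
prime∣product [] pp [] d = ⊥-elim (prime≢1 pp (∣1⇒≡1 d))
prime∣product (x ∷ xs) pp (px ∷ pxs) d with euclidsLemma x (product xs) pp d
... | inj₂ h = there (prime∣product xs pp pxs h)
... | inj₁ h with prime⇒irreducible px h
...   | inj₁ p≡1 = ⊥-elim (prime≢1 pp p≡1)
...   | inj₂ e = here e

coprime-*-∣ : ∀ {a b X} → Coprime a b → a ∣ X → b ∣ X → a * b ∣ X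
coprime-*-∣ {a} {b} cop a∣X (divides q refl) =
  subst (_∣ q * b) (NP.*-comm b a)
    (subst (b * a ∣_) (NP.*-comm b q) (*-pres-∣ (∣-refl {b}) (coprime-divisor cop (subst (a ∣_) (NP.*-comm q b) a∣X))))

distinctPrimes-∣ : ∀ {X} xs → Unique xs → All Prime xs → All (_∣ X) xs → product xs ∣ X
distinctPrimes-∣ [] _ _ _ = 1∣ _
distinctPrimes-∣ (x ∷ xs) (x∉ ∷ u) (px ∷ pxs) (dx ∷ dxs) =
  coprime-*-∣ (prime-coprime px (λ d → All.lookup x∉ (prime∣product xs px pxs d) refl)) dx (distinctPrimes-∣ xs u pxs dxs)

product≥ : ∀ {n} xs → All (n ≤_) xs → n ^ length xs ≤ product xs
product≥ [] [] = NP.≤-refl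
product≥ (x ∷ xs) (h ∷ hs) = NP.*-mono-≤ h (product≥ xs hs)

chebyshev : ∀ n V → Unique V → All (λ p → Prime p × n < p × p ≤ n + n) V → suc n ^ length V ≤ 4 ^ n
chebyshev n V u h = begin
    suc n ^ length V
  ≤⟨ product≥ V (All.map (proj₁ ∘ proj₂) h) ⟩
    product V
  ≤⟨ ∣⇒≤ {{binom-nonZero n n}} (distinctPrimes-∣ V u (All.map proj₁ h) (All.map (λ { (pp , n<p , p≤2n) → prime∣centralBinom n pp n<p p≤2n }) h)) ⟩
    binom n n
  ≤⟨ centralBinom≤4^ n ⟩
    4 ^ n
  ∎
  where open NP.≤-Reasoning

≤-prime? : (T p : ℕ) → Dec (Prime p × p ≤ T)
≤-prime? T p = prime? p ×-dec p NP.≤? T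

inBlock? : (a b p : ℕ) → Dec (Prime p × a < p × p ≤ b)
inBlock? a b p = prime? p ×-dec (a NP.<? p ×-dec p NP.≤? b)

primeRecipSum : ℕ → List ℕ → ℚ
primeRecipSum T U = Σℚ (λ p → guard (does (≤-prime? T p)) (invℕ p)) U

blockSum : ℕ → ℕ → List ℕ → ℚ
blockSum a b U = Σℚ (λ p → guard (does (inBlock? a b p)) (invℕ p)) U

blockCount : ℕ → ℕ → List ℕ → ℕ
blockCount a b U = Σℕ (λ p → 𝟙 (does (inBlock? a b p))) U

primeRecipSum-split : ∀ a b U → a ≤ b → primeRecipSum b U ≡ primeRecipSum a U ℚ.+ blockSum a b U
primeRecipSum-split a b U a≤b = trans (Σℚ-cong U (λ p → split (prime? p) (p NP.≤? a) (a NP.<? p) (p NP.≤? b)))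
                                       (Σℚ-+ _ _ U)
  where
  split : ∀ {p x} (dp : Dec (Prime p)) (da : Dec (p ≤ a)) (dl : Dec (a < p)) (db : Dec (p ≤ b)) →
    guard (does (dp ×-dec db)) x ≡ guard (does (dp ×-dec da)) x ℚ.+ guard (does (dp ×-dec (dl ×-dec db))) x
  split (no _) da dl db = refl
  split (yes _) (yes p≤a) (yes a<p) db = ⊥-elim (NP.<⇒≱ a<p p≤a)
  split (yes _) (yes _) (no _) (yes _) = sym (QP.+-identityʳ _)
  split (yes _) (yes p≤a) (no _) (no p≰b) = ⊥-elim (p≰b (NP.≤-trans p≤a a≤b))
  split (yes _) (no _) (yes _) (yes _) = sym (QP.+-identityˡ _)
  split (yes _) (no _) (yes _) (no _) = refl
  split (yes _) (no p≰a) (no a≮p) db = ⊥-elim (a≮p (NP.≰⇒> p≰a))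

primeRecipSum-1 : ∀ U → primeRecipSum 1 U ≡ 0ℚ
primeRecipSum-1 U = trans (Σℚ-cong U (λ p → no-prime≤1 (prime? p) (p NP.≤? 1))) (Σℚ-zero U)
  where
  no-prime≤1 : ∀ {p} (dp : Dec (Prime p)) (db : Dec (p ≤ 1)) → guard (does (dp ×-dec db)) (invℕ p) ≡ 0ℚ
  no-prime≤1 (no _) _ = refl
  no-prime≤1 (yes _) (no _) = refl
  no-prime≤1 (yes pp) (yes p≤1) = ⊥-elim (NP.<⇒≱ (prime≥2 pp) p≤1)

-- each of the C primes in (a, b] contributes at most 1/(a+1)
blockSum≤ : ∀ a k b U → a ≡ suc k → blockSum a b U ℚ.≤ frac (blockCount a b U) k
blockSum≤ .(suc k) k b U refl = begin
    blockSum (suc k) b U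
  ≤⟨ Σℚ-mono U (λ p → guard-mono (inBlock? (suc k) b p) (λ { (_ , k<p , _) → invℕ≤ p k<p })) ⟩
    Σℚ (λ p → guard (does (inBlock? (suc k) b p)) (frac 1 k)) U
  ≡⟨ Σℚ-guard (λ p → does (inBlock? (suc k) b p)) (frac 1 k) U ⟩
    ι (blockCount (suc k) b U) ℚ.* frac 1 k
  ≡⟨ sym (frac-split (blockCount (suc k) b U) k) ⟩
    frac (blockCount (suc k) b U) k
  ∎
  where
  open QP.≤-Reasoning
  invℕ≤ : ∀ p → suc k < p → invℕ p ℚ.≤ frac 1 k
  invℕ≤ (suc p) k<p = frac-≤ 1 p 1 k (NP.*-monoʳ-≤ 1 (NP.<⇒≤ k<p))

blockCount-bound : ∀ n b U → b ≤ n + n → Unique U → suc n ^ blockCount n b U ≤ 4 ^ n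
blockCount-bound n b U b≤2n u = subst (λ C → suc n ^ C ≤ 4 ^ n) (length-filter-Σ (inBlock? n b) U)
  (chebyshev n (filter (inBlock? n b) U) (UniqueP.filter⁺ (inBlock? n b) u)
     (All.map (λ { (pp , n<p , p≤b) → pp , n<p , NP.≤-trans p≤b b≤2n }) (AllP.all-filter (inBlock? n b) U)))

2^suc : ∀ t → 2 ^ suc t ≡ 2 ^ t + 2 ^ t
2^suc t = cong (2 ^ t +_) (NP.+-identityʳ _)

2^≡suc : ∀ i → 2 ^ i ≡ suc (2 ^ i ∸ 1)
2^≡suc i = trans (sym (NP.m∸n+n≡m {2 ^ i} {1} (NP.m^n>0 2 i))) (NP.+-comm (2 ^ i ∸ 1) 1)

2^-cancel-≤ : ∀ {x y} → 2 ^ x ≤ 2 ^ y → x ≤ y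
2^-cancel-≤ {x} {y} h with x NP.≤? y
... | yes x≤y = x≤y
... | no x≰y = ⊥-elim (NP.<⇒≱ (NP.^-monoʳ-< 2 (s≤s (s≤s z≤n)) (NP.≰⇒> x≰y)) h)

-- Σ_{2^i < p ≤ 2^{i+1}} 1/p ≤ 2/2^i: with C primes there, 2^{iC} ≤ (2^i+1)^C ≤ 4^{2^i}.
dyadicBlock≤ : ∀ i U → Unique U → blockSum (2 ^ i) (2 ^ suc i) U ℚ.≤ frac 2 (i ∸ 1)
dyadicBlock≤ i U u = QP.≤-trans (blockSum≤ (2 ^ i) (2 ^ i ∸ 1) (2 ^ suc i) U (2^≡suc i))
                                (frac-≤ C (2 ^ i ∸ 1) 2 (i ∸ 1) C*s≤2*2^i)
  where
  C = blockCount (2 ^ i) (2 ^ suc i) U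
  s = suc (i ∸ 1)
  2^s≤ : ∀ i → 2 ^ suc (i ∸ 1) ≤ suc (2 ^ i)
  2^s≤ zero = NP.≤-refl
  2^s≤ (suc j) = NP.n≤1+n _
  powers : 2 ^ (s * C) ≤ 2 ^ (2 * 2 ^ i)
  powers = begin
      2 ^ (s * C)
    ≡⟨ sym (NP.^-*-assoc 2 s C) ⟩
      (2 ^ s) ^ C
    ≤⟨ NP.^-monoˡ-≤ C (2^s≤ i) ⟩
      suc (2 ^ i) ^ C
    ≤⟨ blockCount-bound (2 ^ i) (2 ^ suc i) U (NP.≤-reflexive (2^suc i)) u ⟩
      4 ^ (2 ^ i)
    ≡⟨ NP.^-*-assoc 2 2 (2 ^ i) ⟩
      2 ^ (2 * 2 ^ i)
    ∎
    where open NP.≤-Reasoning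
  C*s≤2*2^i : C * s ≤ 2 * suc (2 ^ i ∸ 1)
  C*s≤2*2^i = subst₂ _≤_ (NP.*-comm s C) (cong (2 *_) (2^≡suc i)) (2^-cancel-≤ powers)

primeRecipSum-dyadic : ∀ L r U → Unique U →
  primeRecipSum (2 ^ (L + r)) U ℚ.≤ primeRecipSum (2 ^ L) U ℚ.+ frac (2 * r) (L ∸ 1)
primeRecipSum-dyadic L zero U u = QP.≤-reflexive (begin
    primeRecipSum (2 ^ (L + 0)) U
  ≡⟨ cong (λ z → primeRecipSum (2 ^ z) U) (NP.+-identityʳ L) ⟩
    primeRecipSum (2 ^ L) U
  ≡⟨ sym (QP.+-identityʳ _) ⟩
    primeRecipSum (2 ^ L) U ℚ.+ 0ℚ
  ≡⟨ cong (primeRecipSum (2 ^ L) U ℚ.+_) (sym (frac-≡ 0 (L ∸ 1) 0 0 refl)) ⟩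
    primeRecipSum (2 ^ L) U ℚ.+ frac 0 (L ∸ 1)
  ∎)
  where open ≡-Reasoning
primeRecipSum-dyadic L (suc r) U u = begin
    primeRecipSum (2 ^ (L + suc r)) U
  ≡⟨ cong (λ z → primeRecipSum (2 ^ z) U) (NP.+-suc L r) ⟩
    primeRecipSum (2 ^ suc (L + r)) U
  ≡⟨ primeRecipSum-split (2 ^ (L + r)) (2 ^ suc (L + r)) U (NP.^-monoʳ-≤ 2 (NP.n≤1+n (L + r))) ⟩
    primeRecipSum (2 ^ (L + r)) U ℚ.+ blockSum (2 ^ (L + r)) (2 ^ suc (L + r)) U
  ≤⟨ QP.+-mono-≤ (primeRecipSum-dyadic L r U u) (QP.≤-trans (dyadicBlock≤ (L + r) U u) lastBlock) ⟩
    (primeRecipSum (2 ^ L) U ℚ.+ frac (2 * r) (L ∸ 1)) ℚ.+ frac 2 (L ∸ 1)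
  ≡⟨ QP.+-assoc (primeRecipSum (2 ^ L) U) (frac (2 * r) (L ∸ 1)) (frac 2 (L ∸ 1)) ⟩
    primeRecipSum (2 ^ L) U ℚ.+ (frac (2 * r) (L ∸ 1) ℚ.+ frac 2 (L ∸ 1))
  ≡⟨ cong (primeRecipSum (2 ^ L) U ℚ.+_) (trans (frac-+ (2 * r) 2 (L ∸ 1)) (cong (λ z → frac z (L ∸ 1)) (2r+2 r))) ⟩
    primeRecipSum (2 ^ L) U ℚ.+ frac (2 * suc r) (L ∸ 1)
  ∎
  where
  open QP.≤-Reasoning
  lastBlock : frac 2 (L + r ∸ 1) ℚ.≤ frac 2 (L ∸ 1)
  lastBlock = frac-≤ 2 (L + r ∸ 1) 2 (L ∸ 1) (NP.*-monoʳ-≤ 2 (s≤s (NP.∸-monoˡ-≤ 1 (NP.m≤m+n L r))))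
  2r+2 : ∀ r → 2 * r + 2 ≡ 2 * suc r
  2r+2 = solve-∀

-- Mertens-type bound: Σ_{p ≤ 2^{2^t}} 1/p ≤ 2 + 2t (doubling the exponent adds at most 2)
primeRecipSum-bound : ∀ t U → Unique U → primeRecipSum (2 ^ (2 ^ t)) U ℚ.≤ ι (2 + 2 * t)
primeRecipSum-bound zero U u = begin
    primeRecipSum 2 U
  ≡⟨ primeRecipSum-split 1 2 U (s≤s z≤n) ⟩
    primeRecipSum 1 U ℚ.+ blockSum 1 2 U
  ≡⟨ trans (cong (ℚ._+ blockSum 1 2 U) (primeRecipSum-1 U)) (QP.+-identityˡ _) ⟩
    blockSum (2 ^ 0) (2 ^ 1) U
  ≤⟨ dyadicBlock≤ 0 U u ⟩
    frac 2 0
  ∎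
  where open QP.≤-Reasoning
primeRecipSum-bound (suc t) U u = begin
    primeRecipSum (2 ^ (2 ^ suc t)) U
  ≡⟨ cong (λ z → primeRecipSum (2 ^ z) U) (2^suc t) ⟩
    primeRecipSum (2 ^ (2 ^ t + 2 ^ t)) U
  ≤⟨ primeRecipSum-dyadic (2 ^ t) (2 ^ t) U u ⟩
    primeRecipSum (2 ^ (2 ^ t)) U ℚ.+ frac (2 * 2 ^ t) (2 ^ t ∸ 1)
  ≡⟨ cong (primeRecipSum (2 ^ (2 ^ t)) U ℚ.+_) (frac-≡ (2 * 2 ^ t) (2 ^ t ∸ 1) 2 0 (trans (NP.*-identityʳ _) (cong (2 *_) (2^≡suc t)))) ⟩
    primeRecipSum (2 ^ (2 ^ t)) U ℚ.+ ι 2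
  ≤⟨ QP.+-monoˡ-≤ (ι 2) (primeRecipSum-bound t U u) ⟩
    ι (2 + 2 * t) ℚ.+ ι 2
  ≡⟨ trans (sym (ι-+ (2 + 2 * t) 2)) (cong ι (step t)) ⟩
    ι (2 + 2 * suc t)
  ∎
  where
  open QP.≤-Reasoning
  step : ∀ t → 2 + 2 * t + 2 ≡ 2 + 2 * suc t
  step = solve-∀

-- Bounds for the partial sums of exp y = Σ_j y^j/j!, by comparison with Σ_j K·2^{-j} = 2K.
halfPow : ℕ → ℚ
halfPow j = frac 1 (2 ^ j ∸ 1)

halfPow-nonneg : ∀ j → 0ℚ ℚ.≤ halfPow j
halfPow-nonneg j = invℕ-nonneg (suc (2 ^ j ∸ 1))

halfPow-halves : ∀ j → halfPow (suc j) ℚ.+ halfPow (suc j) ≡ halfPow j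
halfPow-halves j = trans (frac-+ 1 1 (2 ^ suc j ∸ 1))
  (frac-≡ 2 (2 ^ suc j ∸ 1) 1 (2 ^ j ∸ 1) (trans (cong (2 *_) (sym (2^≡suc j)))
     (trans (sym (NP.*-identityˡ (2 ^ suc j))) (cong (1 *_) (2^≡suc (suc j))))))

halfPow-step : ∀ j → halfPow j ℚ.* frac 1 1 ≡ halfPow (suc j)
halfPow-step j = begin
    halfPow j ℚ.* frac 1 1
  ≡⟨ cong (ℚ._* frac 1 1) (sym (halfPow-halves j)) ⟩
    (halfPow (suc j) ℚ.+ halfPow (suc j)) ℚ.* frac 1 1
  ≡⟨ cong (λ x → (x ℚ.+ x) ℚ.* frac 1 1) (sym (QP.*-identityʳ (halfPow (suc j)))) ⟩
    (halfPow (suc j) ℚ.* 1ℚ ℚ.+ halfPow (suc j) ℚ.* 1ℚ) ℚ.* frac 1 1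
  ≡⟨ cong (ℚ._* frac 1 1) (sym (QP.*-distribˡ-+ (halfPow (suc j)) 1ℚ 1ℚ)) ⟩
    halfPow (suc j) ℚ.* ι 2 ℚ.* frac 1 1
  ≡⟨ QP.*-assoc (halfPow (suc j)) (ι 2) (frac 1 1) ⟩
    halfPow (suc j) ℚ.* (ι 2 ℚ.* frac 1 1)
  ≡⟨ trans (cong (halfPow (suc j) ℚ.*_) (trans (QP.*-comm (ι 2) (frac 1 1)) (invℕ-inverse 1))) (QP.*-identityʳ _) ⟩
    halfPow (suc j)
  ∎
  where open ≡-Reasoning

expTerm-nonneg : ∀ y → 0ℚ ℚ.≤ y → ∀ j → 0ℚ ℚ.≤ expTerm y j
expTerm-nonneg y 0≤y zero = frac-≤ 0 0 1 0 z≤n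
expTerm-nonneg y 0≤y (suc j) = *-nonneg (*-nonneg (expTerm-nonneg y 0≤y j) 0≤y) (invℕ-nonneg (suc j))

expPartial≤geometric : ∀ y K → 0ℚ ℚ.≤ K → (∀ j → expTerm y j ℚ.≤ K ℚ.* halfPow j) → ∀ n → expPartial y n ℚ.≤ K ℚ.+ K
expPartial≤geometric y K 0≤K term≤ n = QP.≤-trans (QP.≤-trans (QP.≤-reflexive (sym (QP.+-identityʳ _)))
    (QP.+-monoʳ-≤ (expPartial y n) (*-nonneg 0≤K (halfPow-nonneg n)))) (withTail n)
  where
  -- invariant: the partial sum plus the remaining geometric tail K·2^{-n} stays ≤ 2K
  withTail : ∀ n → expPartial y n ℚ.+ K ℚ.* halfPow n ℚ.≤ K ℚ.+ K
  withTail zero = QP.+-mono-≤ (QP.≤-trans (term≤ 0) (QP.≤-reflexive (QP.*-identityʳ K))) (QP.≤-reflexive (QP.*-identityʳ K))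
  withTail (suc n) = begin
      expPartial y n ℚ.+ expTerm y (suc n) ℚ.+ K ℚ.* halfPow (suc n)
    ≤⟨ QP.+-monoˡ-≤ (K ℚ.* halfPow (suc n)) (QP.+-monoʳ-≤ (expPartial y n) (term≤ (suc n))) ⟩
      expPartial y n ℚ.+ K ℚ.* halfPow (suc n) ℚ.+ K ℚ.* halfPow (suc n)
    ≡⟨ QP.+-assoc (expPartial y n) _ _ ⟩
      expPartial y n ℚ.+ (K ℚ.* halfPow (suc n) ℚ.+ K ℚ.* halfPow (suc n))
    ≡⟨ cong (expPartial y n ℚ.+_) (trans (sym (QP.*-distribˡ-+ K (halfPow (suc n)) (halfPow (suc n)))) (cong (K ℚ.*_) (halfPow-halves n))) ⟩
      expPartial y n ℚ.+ K ℚ.* halfPow n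
    ≤⟨ withTail n ⟩
      K ℚ.+ K
    ∎
    where open QP.≤-Reasoning

-- for 0 ≤ y ≤ 1/2 the j-th term is ≤ 2^{-j}, so every partial sum is ≤ 2
expPartial-small : ∀ y → 0ℚ ℚ.≤ y → y ℚ.≤ frac 1 1 → ∀ n → expPartial y n ℚ.≤ ι 2
expPartial-small y 0≤y y≤½ = expPartial≤geometric y 1ℚ (frac-≤ 0 0 1 0 z≤n) term≤
  where
  term≤ : ∀ j → expTerm y j ℚ.≤ 1ℚ ℚ.* halfPow j
  term≤ zero = QP.≤-refl
  term≤ (suc j) = begin
      expTerm y j ℚ.* y ℚ.* invℕ (suc j)
    ≤⟨ *-mono-nonneg {expTerm y j ℚ.* y} {halfPow j ℚ.* frac 1 1} {invℕ (suc j)} {1ℚ}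
         (*-nonneg (expTerm-nonneg y 0≤y j) 0≤y) (frac-≤ 0 0 1 0 z≤n)
         (*-mono-nonneg {expTerm y j} {halfPow j} {y} {frac 1 1} (expTerm-nonneg y 0≤y j) (frac-≤ 0 0 1 1 z≤n) (QP.≤-trans (term≤ j) (QP.≤-reflexive (QP.*-identityˡ _))) y≤½)
         (frac-≤ 1 j 1 0 (s≤s z≤n)) ⟩
      halfPow j ℚ.* frac 1 1 ℚ.* 1ℚ
    ≡⟨ trans (QP.*-identityʳ _) (trans (halfPow-step j) (sym (QP.*-identityˡ _))) ⟩
      1ℚ ℚ.* halfPow (suc j)
    ∎
    where open QP.≤-Reasoning

-- X^j · X! ≤ (X+j)!, hence X^j ≤ j! · 2^{X+j} via C(X+j, X) ≤ 2^{X+j}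
pow*!≤! : ∀ X j → X ^ j * X ! ≤ (X + j) !
pow*!≤! X zero = NP.≤-reflexive (trans (NP.*-identityˡ _) (cong _! (sym (NP.+-identityʳ X))))
pow*!≤! X (suc j) = begin
    X * X ^ j * X !
  ≡⟨ NP.*-assoc X (X ^ j) (X !) ⟩
    X * (X ^ j * X !)
  ≤⟨ NP.*-mono-≤ (NP.≤-trans (NP.m≤m+n X j) (NP.n≤1+n _)) (pow*!≤! X j) ⟩
    suc (X + j) * (X + j) !
  ≡⟨ cong _! (sym (NP.+-suc X j)) ⟩
    (X + suc j) !
  ∎
  where open NP.≤-Reasoning

pow≤!*2^ : ∀ X j → X ^ j ≤ j ! * 2 ^ (X + j)
pow≤!*2^ X j = NP.*-cancelʳ-≤ (X ^ j) (j ! * 2 ^ (X + j)) (X !) {{NP._!≢0 X}} (begin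
    X ^ j * X !
  ≤⟨ pow*!≤! X j ⟩
    (X + j) !
  ≡⟨ sym (binom-factorial X j) ⟩
    binom X j * (X ! * j !)
  ≤⟨ NP.*-monoˡ-≤ _ (binom≤2^ X j) ⟩
    2 ^ (X + j) * (X ! * j !)
  ≡⟨ rearrange (2 ^ (X + j)) (X !) (j !) ⟩
    j ! * 2 ^ (X + j) * X !
  ∎)
  where
  open NP.≤-Reasoning
  rearrange : ∀ a b c → a * (b * c) ≡ c * a * b
  rearrange = solve-∀

-- N^j 2^j ≤ j! 16^N (apply the previous bound with X = 4N)
pow*2^≤!*16^ : ∀ N j → N ^ j * 2 ^ j ≤ j ! * 16 ^ N
pow*2^≤!*16^ N j = NP.*-cancelʳ-≤ (N ^ j * 2 ^ j) (j ! * 16 ^ N) (2 ^ j) {{NP.m^n≢0 2 j}} (begin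
    N ^ j * 2 ^ j * 2 ^ j
  ≡⟨ NP.*-assoc (N ^ j) _ _ ⟩
    N ^ j * (2 ^ j * 2 ^ j)
  ≡⟨ cong (N ^ j *_) (sym (^-distribʳ-* 2 2 j)) ⟩
    N ^ j * 4 ^ j
  ≡⟨ trans (NP.*-comm (N ^ j) _) (sym (^-distribʳ-* 4 N j)) ⟩
    (4 * N) ^ j
  ≤⟨ pow≤!*2^ (4 * N) j ⟩
    j ! * 2 ^ (4 * N + j)
  ≡⟨ cong (j ! *_) (NP.^-distribˡ-+-* 2 (4 * N) j) ⟩
    j ! * (2 ^ (4 * N) * 2 ^ j)
  ≡⟨ cong (λ t → j ! * (t * 2 ^ j)) (sym (NP.^-*-assoc 2 4 N)) ⟩
    j ! * (16 ^ N * 2 ^ j)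
  ≡⟨ sym (NP.*-assoc (j !) _ _) ⟩
    j ! * 16 ^ N * 2 ^ j
  ∎)
  where open NP.≤-Reasoning

expTerm*!≤ : ∀ y N → 0ℚ ℚ.≤ y → y ℚ.≤ ι N → ∀ j → expTerm y j ℚ.* ι (j !) ℚ.≤ ι (N ^ j)
expTerm*!≤ y N 0≤y y≤N zero = QP.≤-refl
expTerm*!≤ y N 0≤y y≤N (suc j) = begin
    e ℚ.* y ℚ.* invℕ (suc j) ℚ.* ι (suc j * j !)
  ≡⟨ cong (e ℚ.* y ℚ.* invℕ (suc j) ℚ.*_) (ι-* (suc j) (j !)) ⟩
    e ℚ.* y ℚ.* invℕ (suc j) ℚ.* (ι (suc j) ℚ.* ι (j !))
  ≡⟨ rearrange e y (invℕ (suc j)) (ι (suc j)) (ι (j !)) ⟩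
    e ℚ.* ι (j !) ℚ.* y ℚ.* (invℕ (suc j) ℚ.* ι (suc j))
  ≡⟨ trans (cong (e ℚ.* ι (j !) ℚ.* y ℚ.*_) (invℕ-inverse j)) (QP.*-identityʳ _) ⟩
    e ℚ.* ι (j !) ℚ.* y
  ≤⟨ *-mono-nonneg (*-nonneg (expTerm-nonneg y 0≤y j) (ι-nonneg (j !))) (ι-nonneg N) (expTerm*!≤ y N 0≤y y≤N j) y≤N ⟩
    ι (N ^ j) ℚ.* ι N
  ≡⟨ trans (sym (ι-* (N ^ j) N)) (cong ι (NP.*-comm (N ^ j) N)) ⟩
    ι (N * N ^ j)
  ∎
  where
  open QP.≤-Reasoning
  open +-*-Solver
  e = expTerm y j
  rearrange : ∀ e y i s f → e ℚ.* y ℚ.* i ℚ.* (s ℚ.* f) ≡ (e ℚ.* f) ℚ.* y ℚ.* (i ℚ.* s)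
  rearrange = solve 5 (λ e y i s f → e :* y :* i :* (s :* f) := (e :* f) :* y :* (i :* s)) refl

expPartial-bounded : ∀ y N → 0ℚ ℚ.≤ y → y ℚ.≤ ι N → ∀ n → expPartial y n ℚ.≤ ι (16 ^ N + 16 ^ N)
expPartial-bounded y N 0≤y y≤N n =
  QP.≤-trans (expPartial≤geometric y (ι (16 ^ N)) (ι-nonneg (16 ^ N)) term≤ n) (QP.≤-reflexive (sym (ι-+ (16 ^ N) (16 ^ N))))
  where
  term≤ : ∀ j → expTerm y j ℚ.≤ ι (16 ^ N) ℚ.* halfPow j
  term≤ j = begin
      expTerm y j
    ≡⟨ sym (trans (QP.*-assoc (expTerm y j) (ι (2 ^ j)) (halfPow j)) (trans (cong (expTerm y j ℚ.*_) 2^j*halfPow) (QP.*-identityʳ _))) ⟩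
      expTerm y j ℚ.* ι (2 ^ j) ℚ.* halfPow j
    ≤⟨ QP.*-monoʳ-≤-nonNeg (halfPow j) {{nonNeg (halfPow-nonneg j)}} term*2^j≤ ⟩
      ι (16 ^ N) ℚ.* halfPow j
    ∎
    where
    open QP.≤-Reasoning
    2^j*halfPow : ι (2 ^ j) ℚ.* halfPow j ≡ 1ℚ
    2^j*halfPow = trans (cong (λ z → ι z ℚ.* halfPow j) (2^≡suc j)) (trans (QP.*-comm _ (halfPow j)) (invℕ-inverse (2 ^ j ∸ 1)))
    scaled : expTerm y j ℚ.* ι (2 ^ j) ℚ.* ι (j !) ℚ.≤ ι (16 ^ N) ℚ.* ι (j !)
    scaled = begin
        expTerm y j ℚ.* ι (2 ^ j) ℚ.* ι (j !)
      ≡⟨ trans (QP.*-assoc (expTerm y j) _ _) (trans (cong (expTerm y j ℚ.*_) (QP.*-comm (ι (2 ^ j)) (ι (j !)))) (sym (QP.*-assoc (expTerm y j) _ _))) ⟩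
        expTerm y j ℚ.* ι (j !) ℚ.* ι (2 ^ j)
      ≤⟨ QP.*-monoʳ-≤-nonNeg (ι (2 ^ j)) {{nonNeg (ι-nonneg (2 ^ j))}} (expTerm*!≤ y N 0≤y y≤N j) ⟩
        ι (N ^ j) ℚ.* ι (2 ^ j)
      ≡⟨ sym (ι-* (N ^ j) (2 ^ j)) ⟩
        ι (N ^ j * 2 ^ j)
      ≤⟨ ι-mono (pow*2^≤!*16^ N j) ⟩
        ι (j ! * 16 ^ N)
      ≡⟨ trans (ι-* (j !) (16 ^ N)) (QP.*-comm (ι (j !)) (ι (16 ^ N))) ⟩
        ι (16 ^ N) ℚ.* ι (j !)
      ∎
    term*2^j≤ : expTerm y j ℚ.* ι (2 ^ j) ℚ.≤ ι (16 ^ N)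
    term*2^j≤ = QP.*-cancelʳ-≤-pos (ι (j !)) {{ι-pos (j !) (NP.1≤n! j)}} scaled

module Tuples {A : Set} (xs : List A) where
  n : ℕ
  n = length xs

  Σ-tuples-suc : ∀ k (f : Vec A (suc k) → ℕ) →
    Σℕ f (tuples xs (suc k)) ≡ Σℕ (λ x → Σℕ (λ v → f (x Vec.∷ v)) (tuples xs k)) xs
  Σ-tuples-suc k f = trans (Σℕ-concatMap f (λ x → map (x Vec.∷_) (tuples xs k)) xs)
                           (Σℕ-cong xs (λ x → Σℕ-map f (x Vec.∷_) (tuples xs k)))

  length-tuples : ∀ k → length (tuples xs k) ≡ n ^ k
  length-tuples zero = refl
  length-tuples (suc k) = begin
      length (tuples xs (suc k))
    ≡⟨ sym (trans (Σℕ-const 1 (tuples xs (suc k))) (NP.*-identityˡ _)) ⟩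
      Σℕ (λ _ → 1) (tuples xs (suc k))
    ≡⟨ Σ-tuples-suc k (λ _ → 1) ⟩
      Σℕ (λ x → Σℕ (λ v → 1) (tuples xs k)) xs
    ≡⟨ Σℕ-cong xs (λ x → trans (Σℕ-const 1 (tuples xs k)) (trans (NP.*-identityˡ _) (length-tuples k))) ⟩
      Σℕ (λ x → n ^ k) xs
    ≡⟨ trans (Σℕ-const (n ^ k) xs) (NP.*-comm (n ^ k) n) ⟩
      n * n ^ k
    ∎
    where open ≡-Reasoning

  module SomeEntry {ℓ} {P : A → Set ℓ} (P? : ∀ x → Dec (P x)) where
    c : ℕ
    c = Σℕ (λ y → 𝟙 (does (P? y))) xs

    hasEntry : ∀ {k} → Vec A k → ℕ
    hasEntry v = 𝟙 (does (any? P? (toList v)))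

    withEntry : ℕ → ℕ
    withEntry k = Σℕ hasEntry (tuples xs k)

    𝟙-∨ : ∀ a b → 𝟙 (a ∨ b) ≤ 𝟙 a + 𝟙 b
    𝟙-∨ true b = NP.m≤m+n 1 _
    𝟙-∨ false b = NP.≤-refl

    -- a tuple x ∷ v has an entry in P iff x ∈ P or v has one
    withEntry-suc : ∀ k → withEntry (suc k) ≤ c * n ^ k + withEntry k * n
    withEntry-suc k = begin
        withEntry (suc k)
      ≡⟨ Σ-tuples-suc k hasEntry ⟩
        Σℕ (λ x → Σℕ (λ v → 𝟙 (does (P? x) ∨ does (any? P? (toList v)))) (tuples xs k)) xs
      ≤⟨ Σℕ-mono xs (λ x → Σℕ-mono (tuples xs k) (λ v → 𝟙-∨ (does (P? x)) (does (any? P? (toList v))))) ⟩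
        Σℕ (λ x → Σℕ (λ v → 𝟙 (does (P? x)) + hasEntry v) (tuples xs k)) xs
      ≡⟨ Σℕ-cong xs (λ x → trans (Σℕ-+ (λ _ → 𝟙 (does (P? x))) hasEntry (tuples xs k))
                           (cong (_+ withEntry k) (trans (Σℕ-const _ (tuples xs k)) (cong (𝟙 (does (P? x)) *_) (length-tuples k))))) ⟩
        Σℕ (λ x → 𝟙 (does (P? x)) * n ^ k + withEntry k) xs
      ≡⟨ Σℕ-+ (λ x → 𝟙 (does (P? x)) * n ^ k) (λ _ → withEntry k) xs ⟩
        Σℕ (λ x → 𝟙 (does (P? x)) * n ^ k) xs + Σℕ (λ _ → withEntry k) xs
      ≡⟨ cong₂ _+_ (trans (Σℕ-cong xs (λ x → NP.*-comm _ (n ^ k))) (trans (Σℕ-*ˡ (n ^ k) (λ x → 𝟙 (does (P? x))) xs) (NP.*-comm (n ^ k) c)))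
                   (Σℕ-const (withEntry k) xs) ⟩
        c * n ^ k + withEntry k * n
      ∎
      where open NP.≤-Reasoning

    withEntry-bound : ∀ k → withEntry k * n ≤ k * n ^ k * c
    withEntry-bound zero = z≤n
    withEntry-bound (suc k) = begin
        withEntry (suc k) * n
      ≤⟨ NP.*-monoˡ-≤ n (withEntry-suc k) ⟩
        (c * n ^ k + withEntry k * n) * n
      ≡⟨ NP.*-distribʳ-+ n (c * n ^ k) (withEntry k * n) ⟩
        c * n ^ k * n + withEntry k * n * n
      ≤⟨ NP.+-monoʳ-≤ (c * n ^ k * n) (NP.*-monoˡ-≤ n (withEntry-bound k)) ⟩
        c * n ^ k * n + k * n ^ k * c * n
      ≡⟨ collect c (n ^ k) n k ⟩
        suc k * (n * n ^ k) * c
      ∎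
      where
      open NP.≤-Reasoning
      collect : ∀ c X n k → c * X * n + k * X * c * n ≡ suc k * (n * X) * c
      collect = solve-∀

Σ-select : ∀ c p (g : ℕ → ℕ) → Σℕ (λ s → if does (c NP.≟ s) then g s else 0) (upTo p) ≡ (if does (c NP.<? p) then g c else 0)
Σ-select c zero g = refl
Σ-select c (suc p) g = begin
    Σℕ G (upTo (suc p))
  ≡⟨ cong (Σℕ G) (sym (LP.applyUpTo-∷ʳ (λ x → x) p)) ⟩
    Σℕ G (upTo p ++ [ p ])
  ≡⟨ Σℕ-++ G (upTo p) [ p ] ⟩
    Σℕ G (upTo p) + (G p + 0)
  ≡⟨ cong (_+ (G p + 0)) (Σ-select c p g) ⟩
    (if does (c NP.<? p) then g c else 0) + ((if does (c NP.≟ p) then g p else 0) + 0)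
  ≡⟨ lastStep (c NP.<? p) (c NP.≟ p) (c NP.<? suc p) ⟩
    (if does (c NP.<? suc p) then g c else 0)
  ∎
  where
  open ≡-Reasoning
  G = λ s → if does (c NP.≟ s) then g s else 0
  lastStep : (d1 : Dec (c < p)) (d2 : Dec (c ≡ p)) (d3 : Dec (c < suc p)) →
    (if does d1 then g c else 0) + ((if does d2 then g p else 0) + 0) ≡ (if does d3 then g c else 0)
  lastStep (yes c<p) (yes refl) _ = ⊥-elim (NP.<-irrefl refl c<p)
  lastStep (yes _) (no _) (yes _) = NP.+-identityʳ _
  lastStep (yes c<p) (no _) (no c≮1+p) = ⊥-elim (c≮1+p (NP.≤-trans c<p (NP.n≤1+n _)))
  lastStep (no _) (yes refl) (yes _) = NP.+-identityʳ _
  lastStep (no _) (yes refl) (no c≮1+p) = ⊥-elim (c≮1+p NP.≤-refl)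
  lastStep (no c≮p) (no c≢p) (yes c<1+p) = ⊥-elim (c≢p (NP.≤-antisym (NP.≤-pred c<1+p) (NP.≮⇒≥ c≮p)))
  lastStep (no _) (no _) (no _) = refl

hits : ∀ {m k} → ℕ → Vec (Fin m) k → ℕ → Bool
hits p v s = does (any? (λ z → modN (toℕ z) p ℕ.≟ s) (toList v))

rp-Σ : ∀ {m k} p (v : Vec (Fin m) k) → rp p v ≡ Σℕ (λ s → 𝟙 (hits p v s)) (upTo p)
rp-Σ p v = length-filter-Σ _ (upTo p)

rp-cons : ∀ {m k} q (x : Fin m) (v : Vec (Fin m) k) →
  rp (suc q) (x Vec.∷ v) ≡ rp (suc q) v + 𝟙 (not (hits (suc q) v (modN (toℕ x) (suc q))))
rp-cons q x v = begin
    rp p (x Vec.∷ v)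
  ≡⟨ rp-Σ p (x Vec.∷ v) ⟩
    Σℕ (λ s → 𝟙 (does (x̂ ℕ.≟ s) ∨ hits p v s)) (upTo p)
  ≡⟨ Σℕ-cong (upTo p) (λ s → 𝟙-∨ (does (x̂ ℕ.≟ s)) (hits p v s)) ⟩
    Σℕ (λ s → 𝟙 (hits p v s) + new s) (upTo p)
  ≡⟨ Σℕ-+ (λ s → 𝟙 (hits p v s)) new (upTo p) ⟩
    Σℕ (λ s → 𝟙 (hits p v s)) (upTo p) + Σℕ new (upTo p)
  ≡⟨ cong₂ _+_ (sym (rp-Σ p v)) (Σ-select x̂ p (λ s → 𝟙 (not (hits p v s)))) ⟩
    rp p v + (if does (x̂ NP.<? p) then 𝟙 (not (hits p v x̂)) else 0)
  ≡⟨ cong (rp p v +_) (if-yes (x̂ NP.<? p) (m%n<n (toℕ x) p)) ⟩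
    rp p v + 𝟙 (not (hits p v x̂))
  ∎
  where
  open ≡-Reasoning
  p = suc q
  x̂ = modN (toℕ x) p
  new = λ s → if does (x̂ ℕ.≟ s) then 𝟙 (not (hits p v s)) else 0
  𝟙-∨ : ∀ a b → 𝟙 (a ∨ b) ≡ 𝟙 b + (if a then 𝟙 (not b) else 0)
  𝟙-∨ true true = refl
  𝟙-∨ true false = refl
  𝟙-∨ false b = sym (NP.+-identityʳ _)
  if-yes : ∀ {ℓ} {P : Set ℓ} (d : Dec P) {a b : ℕ} → P → (if does d then a else b) ≡ a
  if-yes (yes _) _ = refl
  if-yes (no ¬p) p = ⊥-elim (¬p p)

rp-single : ∀ {m} q (x : Fin m) → rp (suc q) (x Vec.∷ Vec.[]) ≡ 1
rp-single {m} q x = trans (rp-cons q x Vec.[]) (cong (_+ 1) (trans (rp-Σ (suc q) (Vec.[] {A = Fin m})) (zeros (upTo (suc q)))))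
  where
  zeros : ∀ (l : List ℕ) → Σℕ (λ _ → 0) l ≡ 0
  zeros [] = refl
  zeros (_ ∷ l) = zeros l

-- A tuple x ∷ v with r_p(x ∷ v) ≤ k has either r_p(v) ≤ k-1, or the residue of x is
-- already hit by v; the second kind is counted by Tuples.SomeEntry.
module FewResidues {m} (xs : List (Fin m)) (q : ℕ) where
  open Tuples xs

  p : ℕ
  p = suc q

  residue : Fin m → ℕ
  residue x = modN (toℕ x) p

  sameResidue? : (x z : Fin m) → Dec (residue z ≡ residue x)
  sameResidue? x z = residue z ℕ.≟ residue x

  classSize : Fin m → ℕ
  classSize x = Σℕ (λ y → 𝟙 (does (sameResidue? x y))) xs

  few : ℕ → ℕ
  few k = Σℕ (λ v → 𝟙 (does (rp p v ℕ.≤? k ∸ 1))) (tuples xs k)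

  𝟙≤1 : ∀ b → 𝟙 b ≤ 1
  𝟙≤1 true = NP.≤-refl
  𝟙≤1 false = z≤n

  few-cons : ∀ {r a k} b → r ≡ a + 𝟙 (not b) → (d1 : Dec (r ≤ k)) (d2 : Dec (a ≤ k ∸ 1)) → 𝟙 (does d1) ≤ 𝟙 (does d2) + 𝟙 b
  few-cons true _ d1 d2 = NP.≤-trans (𝟙≤1 (does d1)) (NP.m≤n+m 1 _)
  few-cons false _ (no _) d2 = z≤n
  few-cons false _ (yes _) (yes _) = NP.≤-refl
  few-cons {r} {a} {k} false r≡a+1 (yes r≤k) (no a≰k-1) =
    ⊥-elim (a≰k-1 (NP.≤-trans (NP.≤-reflexive (sym (NP.m+n∸n≡m a 1))) (NP.∸-monoˡ-≤ 1 (subst (_≤ k) r≡a+1 r≤k))))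

  few-suc : ∀ k → few (suc k) ≤ few k * n + Σℕ (λ x → SomeEntry.withEntry (sameResidue? x) k) xs
  few-suc k = begin
      few (suc k)
    ≡⟨ Σ-tuples-suc k (λ v → 𝟙 (does (rp p v ℕ.≤? k))) ⟩
      Σℕ (λ x → Σℕ (λ v → 𝟙 (does (rp p (x Vec.∷ v) ℕ.≤? k))) (tuples xs k)) xs
    ≤⟨ Σℕ-mono xs (λ x → Σℕ-mono (tuples xs k) (λ v →
          few-cons (hits p v (residue x)) (rp-cons q x v) (rp p (x Vec.∷ v) ℕ.≤? k) (rp p v ℕ.≤? k ∸ 1))) ⟩
      Σℕ (λ x → Σℕ (λ v → 𝟙 (does (rp p v ℕ.≤? k ∸ 1)) + 𝟙 (hits p v (residue x))) (tuples xs k)) xs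
    ≡⟨ Σℕ-cong xs (λ x → Σℕ-+ (λ v → 𝟙 (does (rp p v ℕ.≤? k ∸ 1))) (λ v → 𝟙 (hits p v (residue x))) (tuples xs k)) ⟩
      Σℕ (λ x → few k + SomeEntry.withEntry (sameResidue? x) k) xs
    ≡⟨ Σℕ-+ (λ _ → few k) (λ x → SomeEntry.withEntry (sameResidue? x) k) xs ⟩
      Σℕ (λ _ → few k) xs + Σℕ (λ x → SomeEntry.withEntry (sameResidue? x) k) xs
    ≡⟨ cong (_+ Σℕ (λ x → SomeEntry.withEntry (sameResidue? x) k) xs) (Σℕ-const (few k) xs) ⟩
      few k * n + Σℕ (λ x → SomeEntry.withEntry (sameResidue? x) k) xs
    ∎
    where open NP.≤-Reasoning

  few-1 : few 1 ≡ 0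
  few-1 = trans (Σ-tuples-suc 0 (λ v → 𝟙 (does (rp p v ℕ.≤? 0)))) (none xs)
    where
    ¬≤0 : ∀ {r} → r ≡ 1 → (d : Dec (r ≤ 0)) → 𝟙 (does d) ≡ 0
    ¬≤0 _ (no _) = refl
    ¬≤0 refl (yes ())
    none : ∀ (l : List (Fin m)) → Σℕ (λ x → Σℕ (λ v → 𝟙 (does (rp p (x Vec.∷ v) ℕ.≤? 0))) (tuples xs 0)) l ≡ 0
    none [] = refl
    none (x ∷ l) = cong₂ _+_ (trans (NP.+-identityʳ _) (¬≤0 (rp-single q x) (rp p (x Vec.∷ Vec.[]) ℕ.≤? 0))) (none l)

  few-bound : ∀ Φ → (∀ x → classSize x * q ≤ Φ) → ∀ k → few (suc k) * n * q ≤ suc k * suc k * n ^ suc k * Φ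
  few-bound Φ class≤ zero = NP.≤-trans (NP.≤-reflexive (cong (λ t → t * n * q) few-1)) z≤n
  few-bound Φ class≤ (suc k) = begin
      few (suc K) * n * q
    ≤⟨ NP.*-monoˡ-≤ q (NP.*-monoˡ-≤ n (few-suc K)) ⟩
      (few K * n + S) * n * q
    ≡⟨ expand (few K) n S q ⟩
      few K * n * q * n + S * n * q
    ≤⟨ NP.+-mono-≤ (NP.*-monoˡ-≤ n (few-bound Φ class≤ k)) (NP.*-monoˡ-≤ q S*n≤) ⟩
      K * K * n ^ K * Φ * n + Σℕ (λ x → K * n ^ K * classSize x) xs * q
    ≡⟨ cong (K * K * n ^ K * Φ * n +_) (trans (NP.*-comm _ q) (trans (sym (Σℕ-*ˡ q (λ x → K * n ^ K * classSize x) xs))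
          (Σℕ-cong xs (λ x → regroup q K (n ^ K) (classSize x))))) ⟩
      K * K * n ^ K * Φ * n + Σℕ (λ x → K * n ^ K * (classSize x * q)) xs
    ≤⟨ NP.+-monoʳ-≤ (K * K * n ^ K * Φ * n) (Σℕ-mono xs (λ x → NP.*-monoʳ-≤ (K * n ^ K) (class≤ x))) ⟩
      K * K * n ^ K * Φ * n + Σℕ (λ x → K * n ^ K * Φ) xs
    ≡⟨ cong (K * K * n ^ K * Φ * n +_) (Σℕ-const (K * n ^ K * Φ) xs) ⟩
      K * K * n ^ K * Φ * n + K * n ^ K * Φ * n
    ≤⟨ NP.m≤m+n _ (suc K * n ^ K * Φ * n) ⟩
      K * K * n ^ K * Φ * n + K * n ^ K * Φ * n + suc K * n ^ K * Φ * n
    ≡⟨ square K (n ^ K) Φ n ⟩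
      suc K * suc K * (n * n ^ K) * Φ
    ∎
    where
    open NP.≤-Reasoning
    K = suc k
    S = Σℕ (λ x → SomeEntry.withEntry (sameResidue? x) K) xs
    S*n≤ : S * n ≤ Σℕ (λ x → K * n ^ K * classSize x) xs
    S*n≤ = NP.≤-trans (NP.≤-reflexive (trans (NP.*-comm S n) (sym (Σℕ-*ˡ n (λ x → SomeEntry.withEntry (sameResidue? x) K) xs))))
             (Σℕ-mono xs (λ x → NP.≤-trans (NP.≤-reflexive (NP.*-comm n _)) (SomeEntry.withEntry-bound (sameResidue? x) K)))
    expand : ∀ a n S q → (a * n + S) * n * q ≡ a * n * q * n + S * n * q
    expand = solve-∀
    regroup : ∀ q K X y → q * (K * X * y) ≡ K * X * (y * q)
    regroup = solve-∀
    square : ∀ K X Φ n → K * K * X * Φ * n + K * X * Φ * n + suc K * X * Φ * n ≡ suc K * suc K * (n * X) * Φ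
    square = solve-∀

map-unique : ∀ {A B : Set} (g : A → B) (xs : List A) → Unique xs →
  (∀ {a b} → a Mem.∈ xs → b Mem.∈ xs → g a ≡ g b → a ≡ b) → Unique (map g xs)
map-unique g [] _ _ = []
map-unique g (x ∷ xs) (x∉ ∷ u) inj = All.tabulate distinct ∷ map-unique g xs u (λ a b e → inj (there a) (there b) e)
  where
  distinct : ∀ {z} → z Mem.∈ map g xs → g x ≢ z
  distinct z∈ e with MemP.∈-map⁻ g z∈
  ... | w , w∈ , refl = All.lookup x∉ w∈ (inj (here refl) (there w∈) e)

unique-⊆-length : ∀ (xs ys : List ℕ) → Unique xs → (∀ {z} → z Mem.∈ xs → z Mem.∈ ys) → length xs ≤ length ys
unique-⊆-length [] ys _ _ = z≤n
unique-⊆-length (x ∷ xs) ys (x∉ ∷ u) xs⊆ys =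
  NP.≤-trans (s≤s rest) (LP.filter-notAll (λ w → ¬? (x NP.≟ w)) ys (¬¬x≡ (xs⊆ys (here refl))))
  where
  ys' = filter (λ w → ¬? (x NP.≟ w)) ys
  rest : length xs ≤ length ys'
  rest = unique-⊆-length xs ys' u (λ z∈ → MemP.∈-filter⁺ (λ w → ¬? (x NP.≟ w)) (xs⊆ys (there z∈)) (All.lookup x∉ z∈))
  ¬¬x≡ : ∀ {ys} → x Mem.∈ ys → Any (λ w → ¬ (¬ (x ≡ w))) ys
  ¬¬x≡ (here e) = here (λ ne → ne e)
  ¬¬x≡ (there i) = there (¬¬x≡ i)

injection-length : ∀ {A : Set} (g : A → ℕ) (xs : List A) (ys : List ℕ) → Unique xs →
  (∀ {a b} → a Mem.∈ xs → b Mem.∈ xs → g a ≡ g b → a ≡ b) → (∀ {a} → a Mem.∈ xs → g a Mem.∈ ys) → length xs ≤ length ys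
injection-length g xs ys u inj into = subst (_≤ length ys) (LP.length-map g xs)
  (unique-⊆-length (map g xs) ys (map-unique g xs u inj) image⊆)
  where
  image⊆ : ∀ {z} → z Mem.∈ map g xs → z Mem.∈ ys
  image⊆ z∈ with MemP.∈-map⁻ g z∈
  ... | w , w∈ , refl = into w∈

length-cartesianProduct : ∀ {A B : Set} (xs : List A) (ys : List B) → length (cartesianProduct xs ys) ≡ length xs * length ys
length-cartesianProduct [] ys = refl
length-cartesianProduct (x ∷ xs) ys =
  trans (LP.length-++ (map (x ,_) ys)) (cong₂ _+_ (LP.length-map (x ,_) ys) (length-cartesianProduct xs ys))

%-≡⇒∣ : ∀ n x d .{{_ : NonZero n}} → x % n ≡ (x + d) % n → n ∣ d
%-≡⇒∣ n x d e = divides ((x + d) / n ∸ x / n) (begin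
    d
  ≡⟨ sym (NP.m+n∸m≡n x d) ⟩
    (x + d) ∸ x
  ≡⟨ cong₂ _∸_ (m≡m%n+[m/n]*n (x + d) n) (m≡m%n+[m/n]*n x n) ⟩
    ((x + d) % n + (x + d) / n * n) ∸ (x % n + x / n * n)
  ≡⟨ cong (λ t → ((x + d) % n + (x + d) / n * n) ∸ (t + x / n * n)) e ⟩
    ((x + d) % n + (x + d) / n * n) ∸ ((x + d) % n + x / n * n)
  ≡⟨ NP.[m+n]∸[m+o]≡n∸o ((x + d) % n) _ _ ⟩
    (x + d) / n * n ∸ x / n * n
  ≡⟨ sym (NP.*-distribʳ-∸ n ((x + d) / n) (x / n)) ⟩
    ((x + d) / n ∸ x / n) * n
  ∎)
  where open ≡-Reasoning

∣<⇒≡0 : ∀ {n d} → n ∣ d → d < n → d ≡ 0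
∣<⇒≡0 {n} {zero} _ _ = refl
∣<⇒≡0 {n} {suc d} n∣d d<n = ⊥-elim (NP.<⇒≱ d<n (∣⇒≤ n∣d))

-- the ordered case u ≤ v: equal residues give n ∣ c(v-u), hence n ∣ v-u < n, so v = u
affine-%-injective-≤ : ∀ n b c {u v} .{{_ : NonZero n}} → (∀ d → n ∣ c * d → n ∣ d) →
  u ≤ v → v < n → (b + c * u) % n ≡ (b + c * v) % n → v ≡ u
affine-%-injective-≤ n b c {u} {v} cancel u≤v v<n e =
  trans (sym (NP.m+[n∸m]≡n u≤v)) (trans (cong (u +_) d≡0) (NP.+-identityʳ u))
  where
  shift : b + c * v ≡ (b + c * u) + c * (v ∸ u)
  shift = trans (cong (λ t → b + c * t) (sym (NP.m+[n∸m]≡n u≤v)))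
            (trans (cong (b +_) (NP.*-distribˡ-+ c u (v ∸ u))) (sym (NP.+-assoc b (c * u) (c * (v ∸ u)))))
  d≡0 : v ∸ u ≡ 0
  d≡0 = ∣<⇒≡0 (cancel (v ∸ u) (%-≡⇒∣ n (b + c * u) (c * (v ∸ u)) (trans e (cong (_% n) shift))))
              (NP.≤-<-trans (NP.m∸n≤m v u) v<n)

affine-%-injective : ∀ n b c x x' .{{_ : NonZero n}} → x < n → x' < n → (∀ d → n ∣ c * d → n ∣ d) →
  (b + c * x) % n ≡ (b + c * x') % n → x ≡ x'
affine-%-injective n b c x x' x<n x'<n cancel e with NP.≤-total x x'
... | inj₁ x≤x' = sym (affine-%-injective-≤ n b c cancel x≤x' x'<n e)
... | inj₂ x'≤x = affine-%-injective-≤ n b c cancel x'≤x x<n (sym e)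

-- Residue classes of ℤ_m^* modulo a prime factor p of m = m' p with p ∤ m' (m squarefree):
-- for y coprime to m with y ≡ a (mod p), the p-1 shifts y + m' s with a + m' s ≢ 0 (mod p)
-- are distinct units mod m, distinct for distinct y.  Hence #{y ∈ B : y ≡ a} · (p-1) ≤ φ(m).
module ResidueClass (m q m' : ℕ) (m≡m'p : m ≡ m' * suc q) (p-prime : Prime (suc q)) (p∤m' : ¬ (suc q ∣ m'))
                    .{{_ : NonZero m}} where
  p : ℕ
  p = suc q

  p∣m : p ∣ m
  p∣m = divides m' m≡m'p

  m'∣m : m' ∣ m
  m'∣m = divides p (trans m≡m'p (NP.*-comm m' p))

  p∣m'd⇒p∣d : ∀ d → p ∣ m' * d → p ∣ d
  p∣m'd⇒p∣d d h with euclidsLemma m' d p-prime h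
  ... | inj₁ p∣m' = ⊥-elim (p∤m' p∣m')
  ... | inj₂ p∣d = p∣d

  admissible? : ∀ a s → Dec (¬ ((a + m' * s) % p ≡ 0))
  admissible? a s = ¬? ((a + m' * s) % p NP.≟ 0)

  -- s ↦ a + m' s mod p is injective on [0, p), so at most one s < p is inadmissible
  inadmissible≤1 : ∀ a → length (filter (λ s → (a + m' * s) % p NP.≟ 0) (upTo p)) ≤ 1
  inadmissible≤1 a = injection-length (λ s → (a + m' * s) % p) Bad (0 ∷ [])
    (UniqueP.filter⁺ bad? (UniqueP.upTo⁺ p))
    (λ i j e → affine-%-injective p a m' _ _ (below i) (below j) p∣m'd⇒p∣d e)
    (λ i → here (proj₂ (MemP.∈-filter⁻ bad? i)))
    where
    bad? = λ s → (a + m' * s) % p NP.≟ 0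
    Bad = filter bad? (upTo p)
    below : ∀ {s} → s Mem.∈ Bad → s < p
    below i = MemP.∈-upTo⁻ (proj₁ (MemP.∈-filter⁻ bad? i))

  admissible-count : ∀ a → q ≤ length (filter (admissible? a) (upTo p))
  admissible-count a = begin
      q
    ≡⟨ cong (_∸ 1) (sym (trans total (LP.length-upTo p))) ⟩
      (length Good + length Bad) ∸ 1
    ≤⟨ NP.∸-monoˡ-≤ 1 (NP.+-monoʳ-≤ (length Good) (inadmissible≤1 a)) ⟩
      (length Good + 1) ∸ 1
    ≡⟨ NP.m+n∸n≡m (length Good) 1 ⟩
      length Good
    ∎
    where
    open NP.≤-Reasoning
    bad? = λ s → (a + m' * s) % p NP.≟ 0
    Good = filter (admissible? a) (upTo p)
    Bad = filter bad? (upTo p)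
    complementary : ∀ {P : Set} (d : Dec P) → 𝟙 (does (¬? d)) + 𝟙 (does d) ≡ 1
    complementary (yes _) = refl
    complementary (no _) = refl
    total : length Good + length Bad ≡ length (upTo p)
    total = begin-equality
        length Good + length Bad
      ≡⟨ cong₂ _+_ (length-filter-Σ (admissible? a) (upTo p)) (length-filter-Σ bad? (upTo p)) ⟩
        Σℕ (λ s → 𝟙 (does (admissible? a s))) (upTo p) + Σℕ (λ s → 𝟙 (does (bad? s))) (upTo p)
      ≡⟨ sym (Σℕ-+ (λ s → 𝟙 (does (admissible? a s))) (λ s → 𝟙 (does (bad? s))) (upTo p)) ⟩
        Σℕ (λ s → 𝟙 (does (admissible? a s)) + 𝟙 (does (bad? s))) (upTo p)
      ≡⟨ Σℕ-cong (upTo p) (λ s → complementary (bad? s)) ⟩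
        Σℕ (λ _ → 1) (upTo p)
      ≡⟨ trans (Σℕ-const 1 (upTo p)) (NP.*-identityˡ _) ⟩
        length (upTo p)
      ∎

  shift-%p : ∀ y a s → y % p ≡ a → (y + m' * s) % p ≡ (a + m' * s) % p
  shift-%p y a s y≡a = begin
      (y + m' * s) % p
    ≡⟨ %-distribˡ-+ y (m' * s) p ⟩
      (y % p + (m' * s) % p) % p
    ≡⟨ cong (λ t → (t + (m' * s) % p) % p) (sym (m%n%n≡m%n y p)) ⟩
      (y % p % p + (m' * s) % p) % p
    ≡⟨ cong (λ t → (t % p + (m' * s) % p) % p) y≡a ⟩
      (a % p + (m' * s) % p) % p
    ≡⟨ sym (%-distribˡ-+ a (m' * s) p) ⟩
      (a + m' * s) % p
    ∎
    where open ≡-Reasoning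

  -- an admissible shift of a unit is again a unit mod m (coprime to p and to m')
  shift-coprime : ∀ y a s → Coprime y m → ¬ ((a + m' * s) % p ≡ 0) → y % p ≡ a → Coprime ((y + m' * s) % m) m
  shift-coprime y a s y⊥m adm y≡a (d∣z%m , d∣m) = z⊥m (∣n∣m%n⇒∣m d∣m d∣z%m , d∣m)
    where
    z = y + m' * s
    p∤z : ¬ (p ∣ z)
    p∤z p∣z = adm (trans (sym (shift-%p y a s y≡a)) (n∣m⇒m%n≡0 z p p∣z))
    z⊥p : Coprime z p
    z⊥p = Coprimality.sym (prime-coprime p-prime p∤z)
    z⊥m' : Coprime z m'
    z⊥m' {d} (d∣z , d∣m') = y⊥m (∣m+n∣m⇒∣n (subst (d ∣_) (NP.+-comm y (m' * s)) d∣z) (∣m⇒∣m*n s d∣m') , ∣-trans d∣m' m'∣m)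
    z⊥m : Coprime z m
    z⊥m {d} (d∣z , d∣m) = z⊥m' (d∣z , coprime-divisor d⊥p (subst (d ∣_) (trans m≡m'p (NP.*-comm m' p)) d∣m))
      where
      d⊥p : Coprime d p
      d⊥p (e∣d , e∣p) = z⊥p (∣-trans e∣d d∣z , e∣p)

  module _ (B : Subset m) (B⊆units : ∀ x → x ∈ B → Coprime (toℕ x) m) (a : ℕ) where
    inClass? : (y : Fin m) → Dec (modN (toℕ y) p ≡ a)
    inClass? y = modN (toℕ y) p NP.≟ a

    Class : List ℕ
    Class = map toℕ (filter inClass? (elems B))

    Admissible : List ℕ
    Admissible = filter (admissible? a) (upTo p)

    Units : List ℕ
    Units = filter (λ x → coprime? x m) (upTo m)

    lift : ℕ × ℕ → ℕ
    lift (y , s) = (y + m' * s) % m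

    ∈Class : ∀ {y} → y Mem.∈ Class → y < m × Coprime y m × y % p ≡ a
    ∈Class y∈ with MemP.∈-map⁻ toℕ y∈
    ... | x , x∈ , refl with MemP.∈-filter⁻ inClass? {xs = elems B} x∈
    ...   | x∈elems , x≡a with MemP.∈-filter⁻ (_∈? B) {xs = L.allFin m} x∈elems
    ...     | _ , x∈B = FP.toℕ<n x , B⊆units x x∈B , x≡a

    ∈Admissible : ∀ {s} → s Mem.∈ Admissible → s < p × ¬ ((a + m' * s) % p ≡ 0)
    ∈Admissible s∈ with MemP.∈-filter⁻ (admissible? a) s∈
    ... | s∈upTo , adm = MemP.∈-upTo⁻ s∈upTo , adm

    unique-pairs : Unique (cartesianProduct Class Admissible)
    unique-pairs = UniqueP.cartesianProduct⁺
      (UniqueP.map⁺ FP.toℕ-injective (UniqueP.filter⁺ inClass? {xs = elems B} (UniqueP.filter⁺ (_∈? B) {xs = L.allFin m} (UniqueP.allFin⁺ m))))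
      (UniqueP.filter⁺ (admissible? a) (UniqueP.upTo⁺ p))

    lift-unit : ∀ {ys} → ys Mem.∈ cartesianProduct Class Admissible → lift ys Mem.∈ Units
    lift-unit {y , s} i with MemP.∈-cartesianProduct⁻ Class Admissible i
    ... | y∈ , s∈ with ∈Class y∈ | ∈Admissible s∈
    ...   | _ , y⊥m , y≡a | _ , adm =
      MemP.∈-filter⁺ (λ x → coprime? x m) (MemP.∈-upTo⁺ (m%n<n (y + m' * s) m)) (shift-coprime y a s y⊥m adm y≡a)

    -- reducing mod p recovers s; then reducing mod m recovers y
    lift-injective : ∀ {u v} → u Mem.∈ cartesianProduct Class Admissible → v Mem.∈ cartesianProduct Class Admissible →
                     lift u ≡ lift v → u ≡ v
    lift-injective {y , s} {y' , s'} i j e with MemP.∈-cartesianProduct⁻ Class Admissible i | MemP.∈-cartesianProduct⁻ Class Admissible j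
    ... | y∈ , s∈ | y'∈ , s'∈ with ∈Class y∈ | ∈Admissible s∈ | ∈Class y'∈ | ∈Admissible s'∈
    ...   | y<m , _ , y≡a | s<p , _ | y'<m , _ , y'≡a | s'<p , _ = cong₂ _,_ y≡y' s≡s'
      where
      e%p : (y + m' * s) % p ≡ (y' + m' * s') % p
      e%p = trans (sym (m∣n⇒o%n%m≡o%m p m (y + m' * s) p∣m)) (trans (cong (_% p) e) (m∣n⇒o%n%m≡o%m p m (y' + m' * s') p∣m))
      s≡s' : s ≡ s'
      s≡s' = affine-%-injective p a m' s s' s<p s'<p p∣m'd⇒p∣d (trans (sym (shift-%p y a s y≡a)) (trans e%p (shift-%p y' a s' y'≡a)))
      swap : ∀ z t → z + m' * t ≡ m' * t + 1 * z
      swap z t = trans (NP.+-comm z (m' * t)) (cong (m' * t +_) (sym (NP.*-identityˡ z)))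
      y≡y' : y ≡ y'
      y≡y' = affine-%-injective m (m' * s) 1 y y' y<m y'<m (λ d h → subst (m ∣_) (NP.*-identityˡ d) h)
               (trans (cong (_% m) (sym (swap y s))) (trans (trans e (cong (λ t → (y' + m' * t) % m) (sym s≡s'))) (cong (_% m) (swap y' s))))

    classSize-bound : Σℕ (λ y → 𝟙 (does (inClass? y))) (elems B) * q ≤ totient m
    classSize-bound = begin
        Σℕ (λ y → 𝟙 (does (inClass? y))) (elems B) * q
      ≡⟨ cong (_* q) (trans (sym (length-filter-Σ inClass? (elems B))) (sym (LP.length-map toℕ (filter inClass? (elems B))))) ⟩
        length Class * q
      ≤⟨ NP.*-monoʳ-≤ (length Class) (admissible-count a) ⟩
        length Class * length Admissible
      ≡⟨ sym (length-cartesianProduct Class Admissible) ⟩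
        length (cartesianProduct Class Admissible)
      ≤⟨ injection-length lift (cartesianProduct Class Admissible) Units unique-pairs lift-injective lift-unit ⟩
        totient m
      ∎
      where open NP.≤-Reasoning

length-elems : ∀ {m} (B : Subset m) → length (elems B) ≡ ∣ B ∣
length-elems {zero} Vec.[] = refl
length-elems {suc m} (s Vec.∷ B) = trans (length-filter-Σ (_∈? (s Vec.∷ B)) (L.allFin (suc m)))
   (trans (cong (𝟙 (does (Fin.zero ∈? (s Vec.∷ B))) +_) (Σ-tabulate m Fin.suc (λ i → 𝟙 (does (i ∈? (s Vec.∷ B))))))
   (head s))
  where
  import Data.Fin as Fin
  Σ-tabulate : ∀ {A : Set} n (g : Fin n → A) (f : A → ℕ) → Σℕ f (L.tabulate g) ≡ Σℕ (λ i → f (g i)) (L.allFin n)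
  Σ-tabulate zero g f = refl
  Σ-tabulate (suc n) g f = cong (f (g Fin.zero) +_) (trans (Σ-tabulate n (λ i → g (Fin.suc i)) f) (sym (Σ-tabulate n Fin.suc (λ i → f (g i)))))
  tail-count : Σℕ (λ i → 𝟙 (does (i ∈? B))) (L.allFin m) ≡ ∣ B ∣
  tail-count = trans (sym (length-filter-Σ (_∈? B) (L.allFin m))) (length-elems B)
  head : ∀ s → 𝟙 (does (Fin.zero ∈? (s Vec.∷ B))) + Σℕ (λ i → 𝟙 (does (Fin.suc i ∈? (s Vec.∷ B)))) (L.allFin m) ≡ ∣ s Vec.∷ B ∣
  head true = cong suc tail-count
  head false = tail-count

|B|≤φ : ∀ {m} (B : Subset m) → (∀ x → x ∈ B → Coprime (toℕ x) m) → length (elems B) ≤ totient m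
|B|≤φ {m} B B⊆units = injection-length toℕ (elems B) (filter (λ x → coprime? x m) (upTo m))
   (UniqueP.filter⁺ (_∈? B) {xs = L.allFin m} (UniqueP.allFin⁺ m))
   (λ _ _ e → FP.toℕ-injective e)
   (λ {a} a∈ → MemP.∈-filter⁺ (λ x → coprime? x m) (MemP.∈-upTo⁺ (FP.toℕ<n a))
      (B⊆units a (proj₂ (MemP.∈-filter⁻ (_∈? B) {xs = L.allFin m} a∈))))

-- Telescoping: Σ_{T < p < N} 1/(p(p-1)) ≤ 1/T, from 1/(p(p-1)) + 1/p = 1/(p-1).
telescopeTerm : ℕ → ℚ
telescopeTerm p = invℕ p ℚ.* invℕ (p ∸ 1)

telescopeTerm-identity : ∀ r → telescopeTerm (suc (suc r)) ℚ.+ invℕ (suc (suc r)) ≡ invℕ (suc r)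
telescopeTerm-identity r = begin
    a ℚ.* b ℚ.+ a
  ≡⟨ cong (a ℚ.* b ℚ.+_) (sym (QP.*-identityʳ a)) ⟩
    a ℚ.* b ℚ.+ a ℚ.* 1ℚ
  ≡⟨ sym (QP.*-distribˡ-+ a b 1ℚ) ⟩
    a ℚ.* (b ℚ.+ 1ℚ)
  ≡⟨ cong (λ z → a ℚ.* (b ℚ.+ z)) (sym (invℕ-inverse r)) ⟩
    a ℚ.* (b ℚ.+ b ℚ.* ι (suc r))
  ≡⟨ cong (a ℚ.*_) (trans (cong (ℚ._+ b ℚ.* ι (suc r)) (sym (QP.*-identityʳ b))) (sym (QP.*-distribˡ-+ b 1ℚ (ι (suc r))))) ⟩
    a ℚ.* (b ℚ.* (1ℚ ℚ.+ ι (suc r)))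
  ≡⟨ cong (λ z → a ℚ.* (b ℚ.* z)) (sym (ι-+ 1 (suc r))) ⟩
    a ℚ.* (b ℚ.* ι (suc (suc r)))
  ≡⟨ trans (sym (QP.*-assoc a b _)) (trans (cong (ℚ._* ι (suc (suc r))) (QP.*-comm a b)) (QP.*-assoc b a _)) ⟩
    b ℚ.* (a ℚ.* ι (suc (suc r)))
  ≡⟨ trans (cong (b ℚ.*_) (invℕ-inverse (suc r))) (QP.*-identityʳ b) ⟩
    b
  ∎
  where
  open ≡-Reasoning
  a = invℕ (suc (suc r))
  b = invℕ (suc r)

tailTerm : ℕ → ℕ → ℚ
tailTerm T p = guard (does (T NP.<? p)) (telescopeTerm p)

-- invariant: the partial sum up to N, plus 1/max(N-1, T), equals 1/T
telescope : ∀ T N → 1 ≤ T → Σℚ (tailTerm T) (upTo N) ℚ.+ invℕ ((N ∸ 1) ⊔ T) ≡ invℕ T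
telescope T zero _ = trans (QP.+-identityˡ _) (cong invℕ (NP.⊔-identityˡ T))
telescope T (suc N) 1≤T = begin
    Σℚ (tailTerm T) (upTo (suc N)) ℚ.+ invℕ (N ⊔ T)
  ≡⟨ cong (λ z → Σℚ (tailTerm T) z ℚ.+ invℕ (N ⊔ T)) (sym (LP.applyUpTo-∷ʳ (λ x → x) N)) ⟩
    Σℚ (tailTerm T) (upTo N ++ [ N ]) ℚ.+ invℕ (N ⊔ T)
  ≡⟨ cong (ℚ._+ invℕ (N ⊔ T)) (trans (Σℚ-++ (tailTerm T) (upTo N) [ N ]) (cong (Σℚ (tailTerm T) (upTo N) ℚ.+_) (QP.+-identityʳ _))) ⟩
    (Σℚ (tailTerm T) (upTo N) ℚ.+ tailTerm T N) ℚ.+ invℕ (N ⊔ T)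
  ≡⟨ QP.+-assoc (Σℚ (tailTerm T) (upTo N)) (tailTerm T N) (invℕ (N ⊔ T)) ⟩
    Σℚ (tailTerm T) (upTo N) ℚ.+ (tailTerm T N ℚ.+ invℕ (N ⊔ T))
  ≡⟨ cong (Σℚ (tailTerm T) (upTo N) ℚ.+_) (lastTerm (T NP.<? N) 1≤T) ⟩
    Σℚ (tailTerm T) (upTo N) ℚ.+ invℕ ((N ∸ 1) ⊔ T)
  ≡⟨ telescope T N 1≤T ⟩
    invℕ T
  ∎
  where
  open ≡-Reasoning
  lastTerm : ∀ {T N} (d : Dec (T < N)) → 1 ≤ T →
    (if does d then telescopeTerm N else 0ℚ) ℚ.+ invℕ (N ⊔ T) ≡ invℕ ((N ∸ 1) ⊔ T)
  lastTerm {T} {N} (no T≮N) _ = trans (QP.+-identityˡ _)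
    (cong invℕ (trans (NP.m≤n⇒m⊔n≡n (NP.≮⇒≥ T≮N)) (sym (NP.m≤n⇒m⊔n≡n (NP.≤-trans (NP.m∸n≤m N 1) (NP.≮⇒≥ T≮N))))))
  lastTerm {suc T} {suc (suc r)} (yes T<N) _ = trans (cong (telescopeTerm (suc (suc r)) ℚ.+_) (cong invℕ (NP.m≥n⇒m⊔n≡m (NP.<⇒≤ T<N))))
    (trans (telescopeTerm-identity r) (cong invℕ (sym (NP.m≥n⇒m⊔n≡m (NP.≤-pred T<N)))))
  lastTerm {suc T} {suc zero} (yes (s≤s ())) _
  lastTerm {zero} (yes _) ()

telescope-bound : ∀ T N → 1 ≤ T → Σℚ (tailTerm T) (upTo N) ℚ.≤ invℕ T
telescope-bound T N 1≤T = QP.≤-trans (QP.≤-trans (QP.≤-reflexive (sym (QP.+-identityʳ _)))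
   (QP.+-monoʳ-≤ (Σℚ (tailTerm T) (upTo N)) (invℕ-nonneg ((N ∸ 1) ⊔ T)))) (QP.≤-reflexive (telescope T N 1≤T))

+-cancelˡ-≤ : ∀ a b c → a ℚ.+ b ℚ.≤ a ℚ.+ c → b ℚ.≤ c
+-cancelˡ-≤ a b c h = subst₂ ℚ._≤_ (cancel a b) (cancel a c) (QP.+-monoʳ-≤ (ℚ.- a) h)
  where
  open +-*-Solver
  cancel : ∀ a b → ℚ.- a ℚ.+ (a ℚ.+ b) ≡ b
  cancel = solve 2 (λ a b → (:- a) :+ (a :+ b) := b) refl

markov-pointwise : ∀ {β f Q X} (d : Dec (β ℚ.≤ f)) → f ℚ.≤ Q ℚ.+ X → Q ℚ.+ Q ℚ.≤ β → 0ℚ ℚ.≤ X →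
                   guard (does d) β ℚ.≤ X ℚ.+ X
markov-pointwise {X = X} (no _) _ _ 0≤X = QP.≤-trans 0≤X (QP.≤-trans (QP.≤-reflexive (sym (QP.+-identityʳ X))) (QP.+-monoʳ-≤ X 0≤X))
markov-pointwise {β} {f} {Q} {X} (yes β≤f) f≤Q+X 2Q≤β _ = +-cancelˡ-≤ β β (X ℚ.+ X) (begin
    β ℚ.+ β
  ≤⟨ QP.+-mono-≤ (QP.≤-trans β≤f f≤Q+X) (QP.≤-trans β≤f f≤Q+X) ⟩
    (Q ℚ.+ X) ℚ.+ (Q ℚ.+ X)
  ≡⟨ interchange Q X Q X ⟩
    (Q ℚ.+ Q) ℚ.+ (X ℚ.+ X)
  ≤⟨ QP.+-monoˡ-≤ (X ℚ.+ X) 2Q≤β ⟩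
    β ℚ.+ (X ℚ.+ X)
  ∎)
  where
  open QP.≤-Reasoning
  open +-*-Solver
  interchange : ∀ a b c d → (a ℚ.+ b) ℚ.+ (c ℚ.+ d) ≡ (a ℚ.+ c) ℚ.+ (b ℚ.+ d)
  interchange = solve 4 (λ a b c d → (a :+ b) :+ (c :+ d) := (a :+ c) :+ (b :+ d)) refl

module Counting (m : ℕ) (B : Subset m) (k' : ℕ) (β : ℚ) where
  k n : ℕ
  k = suc k'
  n = length (elems B)

  U : List ℕ
  U = upTo (suc m)

  tups : List (Vec (Fin m) k)
  tups = tuples (elems B) k

  primeDivisor? : (p : ℕ) → Dec (Prime p × p ∣ m)
  primeDivisor? p = prime? p ×-dec p ∣? m

  few? : Vec (Fin m) k → ℕ → Bool
  few? v p = does (rp p v ℕ.≤? k ∸ 1)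

  fval-Σ : ∀ v → fval m k v ≡ Σℚ (λ p → guard (does (primeDivisor? p)) (guard (few? v p) (invℕ p))) U
  fval-Σ v = trans (Σℚ-foldr invℕ (filter (λ p → rp p v ℕ.≤? k ∸ 1) (filter primeDivisor? U)))
               (trans (Σℚ-filter (λ p → rp p v ℕ.≤? k ∸ 1) invℕ (filter primeDivisor? U))
                      (Σℚ-filter primeDivisor? (λ p → guard (few? v p) (invℕ p)) U))

  large? : (T p : ℕ) → Dec ((Prime p × p ∣ m) × T < p)
  large? T p = primeDivisor? p ×-dec (T NP.<? p)

  tailPart : ℕ → Vec (Fin m) k → ℚ
  tailPart T v = Σℚ (λ p → guard (does (large? T p)) (guard (few? v p) (invℕ p))) U

  tailPart-nonneg : ∀ T v → 0ℚ ℚ.≤ tailPart T v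
  tailPart-nonneg T v = Σℚ-nonneg _ U (λ p → guard-nonneg (does (large? T p)) (guard-nonneg (few? v p) (invℕ-nonneg p)))

  fval-split : ∀ T v → fval m k v ℚ.≤ primeRecipSum T U ℚ.+ tailPart T v
  fval-split T v = begin
      fval m k v
    ≡⟨ fval-Σ v ⟩
      Σℚ (λ p → guard (does (primeDivisor? p)) (guard (few? v p) (invℕ p))) U
    ≤⟨ Σℚ-mono U (λ p → split (few? v p) (prime? p) (p ∣? m) (p NP.≤? T) (T NP.<? p)) ⟩
      Σℚ (λ p → guard (does (≤-prime? T p)) (invℕ p) ℚ.+ guard (does (large? T p)) (guard (few? v p) (invℕ p))) U
    ≡⟨ Σℚ-+ (λ p → guard (does (≤-prime? T p)) (invℕ p)) (λ p → guard (does (large? T p)) (guard (few? v p) (invℕ p))) U ⟩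
      primeRecipSum T U ℚ.+ tailPart T v
    ∎
    where
    open QP.≤-Reasoning
    split : ∀ {p} (b : Bool) (dpr : Dec (Prime p)) (ddv : Dec (p ∣ m)) (dle : Dec (p ≤ T)) (dlt : Dec (T < p)) →
      guard (does (dpr ×-dec ddv)) (guard b (invℕ p)) ℚ.≤
        guard (does (dpr ×-dec dle)) (invℕ p) ℚ.+ guard (does ((dpr ×-dec ddv) ×-dec dlt)) (guard b (invℕ p))
    split b (no _) ddv dle dlt = QP.≤-refl
    split {p} b (yes _) (no _) dle dlt = QP.≤-trans (guard-nonneg (does dle) (invℕ-nonneg p)) (QP.≤-reflexive (sym (QP.+-identityʳ _)))
    split {p} b (yes _) (yes _) (yes _) dlt = QP.≤-trans (guard≤ b) (QP.≤-trans (QP.≤-reflexive (sym (QP.+-identityʳ _)))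
         (QP.+-monoʳ-≤ (invℕ p) (guard-nonneg (does dlt) (guard-nonneg b (invℕ-nonneg p)))))
      where
      guard≤ : ∀ b → guard b (invℕ p) ℚ.≤ invℕ p
      guard≤ true = QP.≤-refl
      guard≤ false = invℕ-nonneg p
    split b (yes _) (yes _) (no _) (yes _) = QP.≤-reflexive (sym (QP.+-identityˡ _))
    split b (yes _) (yes _) (no p≰T) (no T≮p) = ⊥-elim (T≮p (NP.≰⇒> p≰T))

  markov : ∀ T → primeRecipSum T U ℚ.+ primeRecipSum T U ℚ.≤ β →
           ι (count m k B β) ℚ.* β ℚ.≤ Σℚ (tailPart T) tups ℚ.+ Σℚ (tailPart T) tups
  markov T 2Q≤β = begin
      ι (count m k B β) ℚ.* β
    ≡⟨ cong (λ z → ι z ℚ.* β) (length-filter-Σ (λ v → β QP.≤? fval m k v) tups) ⟩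
      ι (Σℕ (λ v → 𝟙 (does (β QP.≤? fval m k v))) tups) ℚ.* β
    ≡⟨ sym (Σℚ-guard (λ v → does (β QP.≤? fval m k v)) β tups) ⟩
      Σℚ (λ v → guard (does (β QP.≤? fval m k v)) β) tups
    ≤⟨ Σℚ-mono tups (λ v → markov-pointwise {β} {fval m k v} {primeRecipSum T U} {tailPart T v} (β QP.≤? fval m k v) (fval-split T v) 2Q≤β (tailPart-nonneg T v)) ⟩
      Σℚ (λ v → tailPart T v ℚ.+ tailPart T v) tups
    ≡⟨ Σℚ-+ (tailPart T) (tailPart T) tups ⟩
      Σℚ (tailPart T) tups ℚ.+ Σℚ (tailPart T) tups
    ∎
    where open QP.≤-Reasoning

  fewCount : ℕ → ℕ
  fewCount p = Σℕ (λ v → 𝟙 (few? v p)) tups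

  Σ-tailPart : ∀ T → Σℚ (tailPart T) tups ≡ Σℚ (λ p → guard (does (large? T p)) (ι (fewCount p) ℚ.* invℕ p)) U
  Σ-tailPart T = trans (Σℚ-swap (λ v p → guard (does (large? T p)) (guard (few? v p) (invℕ p))) tups U)
    (Σℚ-cong U (λ p → trans (guard-Σℚ (does (large? T p)) (λ v → guard (few? v p) (invℕ p)) tups)
      (cong (guard (does (large? T p))) (Σℚ-guard (λ v → few? v p) (invℕ p) tups))))

  module _ (T W N : ℕ) (1≤T : 1 ≤ T) (fewCount≤ : ∀ p → (Prime p × p ∣ m) × T < p → fewCount p * N * (p ∸ 1) ≤ W) where
    perPrime : ∀ p (d : Dec ((Prime p × p ∣ m) × T < p)) (d' : Dec (T < p)) →
      guard (does d) (ι (fewCount p) ℚ.* invℕ p) ℚ.* ι N ℚ.≤ ι W ℚ.* guard (does d') (telescopeTerm p)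
    perPrime p (no _) d' = QP.≤-trans (QP.≤-reflexive (QP.*-zeroˡ (ι N)))
      (*-nonneg (ι-nonneg W) (guard-nonneg (does d') (*-nonneg (invℕ-nonneg p) (invℕ-nonneg (p ∸ 1)))))
    perPrime p (yes (_ , T<p)) (no T≮p) = ⊥-elim (T≮p T<p)
    perPrime (suc (suc r)) (yes large) (yes _) = begin
        ι c ℚ.* ip ℚ.* ι N
      ≡⟨ regroup (ι c) ip (ι N) ⟩
        ip ℚ.* (ι c ℚ.* ι N)
      ≡⟨ cong (ip ℚ.*_) (sym (ι-* c N)) ⟩
        ip ℚ.* ι (c * N)
      ≤⟨ QP.*-monoˡ-≤-nonNeg ip {{nonNeg (invℕ-nonneg (suc (suc r)))}} cN≤W/p-1 ⟩
        ip ℚ.* (ι W ℚ.* invℕ (suc r))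
      ≡⟨ trans (sym (QP.*-assoc ip (ι W) _)) (trans (cong (ℚ._* invℕ (suc r)) (QP.*-comm ip (ι W))) (QP.*-assoc (ι W) ip _)) ⟩
        ι W ℚ.* telescopeTerm (suc (suc r))
      ∎
      where
      open QP.≤-Reasoning
      open +-*-Solver
      c = fewCount (suc (suc r))
      ip = invℕ (suc (suc r))
      regroup : ∀ a b d → a ℚ.* b ℚ.* d ≡ b ℚ.* (a ℚ.* d)
      regroup = solve 3 (λ a b d → a :* b :* d := b :* (a :* d)) refl
      cN≤W/p-1 : ι (c * N) ℚ.≤ ι W ℚ.* invℕ (suc r)
      cN≤W/p-1 = QP.≤-trans (frac-≤ (c * N) 0 W r (NP.≤-trans (NP.≤-reflexive (NP.*-comm (c * N) (suc r)))
          (NP.≤-trans (NP.≤-reflexive (NP.*-comm (suc r) (c * N))) (NP.≤-trans (fewCount≤ (suc (suc r)) large) (NP.≤-reflexive (sym (NP.*-identityʳ W)))))))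
        (QP.≤-reflexive (frac-split W r))

    Σ-tailPart-bound : Σℚ (tailPart T) tups ℚ.* ι N ℚ.≤ ι W ℚ.* invℕ T
    Σ-tailPart-bound = begin
        Σℚ (tailPart T) tups ℚ.* ι N
      ≡⟨ cong (ℚ._* ι N) (Σ-tailPart T) ⟩
        Σℚ F U ℚ.* ι N
      ≡⟨ Σℚ-*ʳ (ι N) F U ⟩
        Σℚ (λ p → F p ℚ.* ι N) U
      ≤⟨ Σℚ-mono U (λ p → perPrime p (large? T p) (T NP.<? p)) ⟩
        Σℚ (λ p → ι W ℚ.* tailTerm T p) U
      ≡⟨ Σℚ-*ˡ (ι W) (tailTerm T) U ⟩
        ι W ℚ.* Σℚ (tailTerm T) U
      ≤⟨ QP.*-monoˡ-≤-nonNeg (ι W) {{nonNeg (ι-nonneg W)}} (telescope-bound T (suc m) 1≤T) ⟩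
        ι W ℚ.* invℕ T
      ∎
      where
      open QP.≤-Reasoning
      F = λ p → guard (does (large? T p)) (ι (fewCount p) ℚ.* invℕ p)

    count-bound : primeRecipSum T U ℚ.+ primeRecipSum T U ℚ.≤ β →
                  ι (count m k B β) ℚ.* β ℚ.* ι N ℚ.≤ ι W ℚ.* invℕ T ℚ.+ ι W ℚ.* invℕ T
    count-bound 2Q≤β = begin
        ι (count m k B β) ℚ.* β ℚ.* ι N
      ≤⟨ QP.*-monoʳ-≤-nonNeg (ι N) {{nonNeg (ι-nonneg N)}} (markov T 2Q≤β) ⟩
        (Σℚ (tailPart T) tups ℚ.+ Σℚ (tailPart T) tups) ℚ.* ι N
      ≡⟨ QP.*-distribʳ-+ (ι N) (Σℚ (tailPart T) tups) (Σℚ (tailPart T) tups) ⟩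
        Σℚ (tailPart T) tups ℚ.* ι N ℚ.+ Σℚ (tailPart T) tups ℚ.* ι N
      ≤⟨ QP.+-mono-≤ Σ-tailPart-bound Σ-tailPart-bound ⟩
        ι W ℚ.* invℕ T ℚ.+ ι W ℚ.* invℕ T
      ∎
      where open QP.≤-Reasoning

  module _ (1≤m : 1 ≤ m) (sqf : Squarefree m) (B⊆units : ∀ x → x ∈ B → Coprime (toℕ x) m) where
    fewCount-bound : ∀ p → Prime p → p ∣ m → fewCount p * n ^ 2 * (p ∸ 1) ≤ k * k * n ^ k * totient m ^ 2
    fewCount-bound (suc q) p-prime (divides m' m≡m'p) = begin
        fewCount (suc q) * n ^ 2 * q
      ≡⟨ regroup (fewCount (suc q)) n q ⟩
        fewCount (suc q) * n * q * n
      ≤⟨ NP.*-monoˡ-≤ n (FewResidues.few-bound (elems B) q φ class≤ k') ⟩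
        k * k * n ^ k * φ * n
      ≤⟨ NP.*-monoʳ-≤ (k * k * n ^ k * φ) (|B|≤φ B B⊆units) ⟩
        k * k * n ^ k * φ * φ
      ≡⟨ square (k * k * n ^ k) φ ⟩
        k * k * n ^ k * φ ^ 2
      ∎
      where
      open NP.≤-Reasoning
      instance
        m≢0 : NonZero m
        m≢0 = ℕ.>-nonZero 1≤m
      φ = totient m
      p∤m' : ¬ (suc q ∣ m')
      p∤m' p∣m' = sqf (suc q) p-prime (subst (suc q * suc q ∣_) (sym m≡m'p) (*-pres-∣ p∣m' ∣-refl))
      class≤ : ∀ x → FewResidues.classSize (elems B) q x * q ≤ φ
      class≤ x = ResidueClass.classSize-bound m q m' m≡m'p p-prime p∤m' B B⊆units (modN (toℕ x) (suc q))
      regroup : ∀ c x y → c * (x * (x * 1)) * y ≡ c * x * y * x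
      regroup = solve-∀
      square : ∀ a b → a * b * b ≡ a * (b * (b * 1))
      square = solve-∀

recipℚ-inverse : ∀ r → Positive r → recipℚ r ℚ.* r ≡ 1ℚ
recipℚ-inverse (mkℚ (ℤ.+ suc n) d c) _ = QP.*-inverseˡ (mkℚ (ℤ.+ suc n) d c)

recipℚ-nonneg : ∀ r → Positive r → 0ℚ ℚ.≤ recipℚ r
recipℚ-nonneg (mkℚ (ℤ.+ suc n) d c) _ = QP.<⇒≤ (QP.positive⁻¹ _ {{QP.1/pos⇒pos (mkℚ (ℤ.+ suc n) d c)}})

exponent-bound : ∀ X W G a b → a ≤ G * suc b → X * 2 ^ G ≤ W → X ^ suc b * 2 ^ a ≤ W ^ suc b
exponent-bound X W G a b a≤G[b+1] X2^G≤W = begin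
    X ^ suc b * 2 ^ a
  ≤⟨ NP.*-monoʳ-≤ (X ^ suc b) (NP.^-monoʳ-≤ 2 a≤G[b+1]) ⟩
    X ^ suc b * 2 ^ (G * suc b)
  ≡⟨ cong (X ^ suc b *_) (sym (NP.^-*-assoc 2 G (suc b))) ⟩
    X ^ suc b * (2 ^ G) ^ suc b
  ≡⟨ sym (^-distribʳ-* X (2 ^ G) (suc b)) ⟩
    (X * 2 ^ G) ^ suc b
  ≤⟨ NP.^-monoˡ-≤ (suc b) X2^G≤W ⟩
    W ^ suc b
  ∎
  where open NP.≤-Reasoning

-- for k = 1 every r_p equals 1, so f vanishes and no tuple reaches β > 0
count-k≡1 : ∀ m (B : Subset m) β → Positive β → count m 1 B β ≡ 0
count-k≡1 m B β β>0 = trans (length-filter-Σ (λ v → β QP.≤? fval m 1 v) tups) (none tups)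
  where
  open Counting m B 0 β using (tups; fval-Σ; U; primeDivisor?; few?)
  noPrime : ∀ (v : Vec (Fin m) 1) p → guard (does (primeDivisor? p)) (guard (few? v p) (invℕ p)) ≡ 0ℚ
  noPrime v p = vanish (primeDivisor? p)
    where
    ¬≤0 : ∀ {r} → r ≡ 1 → (d : Dec (r ≤ 0)) → guard (does d) (invℕ p) ≡ 0ℚ
    ¬≤0 _ (no _) = refl
    ¬≤0 refl (yes ())
    single : ∀ q → Prime q → (v : Vec (Fin m) 1) → guard (few? v q) (invℕ p) ≡ 0ℚ
    single zero q-prime _ = ⊥-elim (NP.<⇒≱ (prime≥2 q-prime) z≤n)
    single (suc r) _ (x Vec.∷ Vec.[]) = ¬≤0 (rp-single r x) (rp (suc r) (x Vec.∷ Vec.[]) ℕ.≤? 0)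
    vanish : (d : Dec (Prime p × p ∣ m)) → guard (does d) (guard (few? v p) (invℕ p)) ≡ 0ℚ
    vanish (no _) = refl
    vanish (yes (p-prime , _)) = single p p-prime v
  fval≡0 : ∀ v → fval m 1 v ≡ 0ℚ
  fval≡0 v = trans (fval-Σ v) (trans (Σℚ-cong U (noPrime v)) (Σℚ-zero U))
  none : ∀ (l : List (Vec (Fin m) 1)) → Σℕ (λ v → 𝟙 (does (β QP.≤? fval m 1 v))) l ≡ 0
  none [] = refl
  none (v ∷ l) = cong₂ _+_ (unreached (β QP.≤? fval m 1 v) (β≰f v)) (none l)
    where
    β≰f : ∀ v → ¬ (β ℚ.≤ fval m 1 v)
    β≰f v β≤f = QP.<-irrefl refl (QP.<-≤-trans (QP.positive⁻¹ β {{β>0}}) (subst (β ℚ.≤_) (fval≡0 v) β≤f))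
    unreached : ∀ {P : Set} (d : Dec P) → ¬ P → 𝟙 (does d) ≡ 0
    unreached (yes p) ¬p = ⊥-elim (¬p p)
    unreached (no _) _ = refl

-- the trivial bound count ≤ |B|^k, with |B| ≤ φ(m) and 2² ≤ k² for k ≥ 2 (for k = 1 the count is 0)
trivial-bound : ∀ m (B : Subset m) β → Positive β → ∀ k' → length (elems B) ≤ totient m →
  count m (suc k') B β * length (elems B) ^ 2 * 2 ^ 2 ≤ suc k' * suc k' * length (elems B) ^ suc k' * totient m ^ 2
trivial-bound m B β β>0 zero _ = NP.≤-trans (NP.≤-reflexive (cong (λ z → z * length (elems B) ^ 2 * 4) (count-k≡1 m B β β>0))) z≤n
trivial-bound m B β β>0 (suc j) n≤φ = begin
    count m k B β * n ^ 2 * 2 ^ 2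
  ≤⟨ NP.*-monoˡ-≤ 4 (NP.*-mono-≤ count≤n^k (NP.^-monoˡ-≤ 2 n≤φ)) ⟩
    n ^ k * φ ^ 2 * 4
  ≤⟨ NP.*-monoʳ-≤ (n ^ k * φ ^ 2) (NP.*-mono-≤ {2} {k} {2} {k} (s≤s (s≤s z≤n)) (s≤s (s≤s z≤n))) ⟩
    n ^ k * φ ^ 2 * (k * k)
  ≡⟨ rotate (n ^ k) (φ ^ 2) (k * k) ⟩
    k * k * n ^ k * φ ^ 2
  ∎
  where
  open NP.≤-Reasoning
  k = suc (suc j)
  n = length (elems B)
  φ = totient m
  count≤n^k : count m k B β ≤ n ^ k
  count≤n^k = NP.≤-trans (LP.length-filter (λ v → β QP.≤? fval m k v) (tuples (elems B) k)) (NP.≤-reflexive (Tuples.length-tuples (elems B) k))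
  rotate : ∀ a b c → a * b * c ≡ c * a * b
  rotate = solve-∀

-- for β > 50 there is N with β ≤ 100 N and 16 N + 12 ≤ β (take N = ⌊β/100⌋ + 1)
choose-N : ∀ β → Positive β → ¬ (β ℚ.≤ ι 50) → ∃ λ N → β ℚ.≤ ι (100 * N) × ι (16 * N + 12) ℚ.≤ β
choose-N β@(mkℚ (ℤ.+ u) d _) _ β≰50 = N , β≤100N , 16N+12≤β
  where
  open NP.≤-Reasoning
  β≡u/d : frac u d ≡ β
  β≡u/d = QP.↥p/↧p≡p β
  D = 100 * suc d
  N = u / D + 1
  50d<u : 50 * suc d < u
  50d<u = NP.≰⇒> (λ u≤50d → β≰50 (subst (ℚ._≤ ι 50) β≡u/d (frac-≤ u d 50 0 (NP.≤-trans (NP.≤-reflexive (NP.*-identityʳ u)) u≤50d))))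
  u≤100Nd : u ≤ 100 * N * suc d
  u≤100Nd = begin
      u
    ≡⟨ m≡m%n+[m/n]*n u D ⟩
      u % D + u / D * D
    ≤⟨ NP.+-monoˡ-≤ (u / D * D) (NP.<⇒≤ (m%n<n u D)) ⟩
      D + u / D * D
    ≡⟨ collect (u / D) d ⟩
      100 * N * suc d
    ∎
    where
    collect : ∀ Q d → 100 * suc d + Q * (100 * suc d) ≡ 100 * (Q + 1) * suc d
    collect = solve-∀
  [16N+12]d≤u : (16 * N + 12) * suc d ≤ u
  [16N+12]d≤u = NP.*-cancelˡ-≤ 100 (begin
      100 * ((16 * N + 12) * suc d)
    ≡⟨ expand (u / D) d ⟩
      16 * (u / D * D) + 56 * (50 * suc d)
    ≤⟨ NP.+-mono-≤ (NP.*-monoʳ-≤ 16 (m/n*n≤m u D)) (NP.*-monoʳ-≤ 56 (NP.<⇒≤ 50d<u)) ⟩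
      16 * u + 56 * u
    ≤⟨ NP.≤-trans (NP.≤-reflexive (sym (NP.*-distribʳ-+ u 16 56))) (NP.*-monoˡ-≤ u (NP.≤-trans (NP.n≤1+n 72) (s≤s (NP.m≤m+n 72 27)))) ⟩
      100 * u
    ∎)
    where
    expand : ∀ Q d → 100 * ((16 * (Q + 1) + 12) * suc d) ≡ 16 * (Q * (100 * suc d)) + 56 * (50 * suc d)
    expand = solve-∀
  β≤100N : β ℚ.≤ ι (100 * N)
  β≤100N = subst (ℚ._≤ ι (100 * N)) β≡u/d (frac-≤ u d (100 * N) 0 (NP.≤-trans (NP.≤-reflexive (NP.*-identityʳ u)) u≤100Nd))
  16N+12≤β : ι (16 * N + 12) ℚ.≤ β
  16N+12≤β = subst (ι (16 * N + 12) ℚ.≤_) β≡u/d (frac-≤ (16 * N + 12) 0 u d (NP.≤-trans [16N+12]d≤u (NP.≤-reflexive (sym (NP.*-identityʳ u)))))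

-- with G = 2·16^N and T = 2^{2^{4N+2}} = 2^{4·16^N}: 2^G · 2 ≤ T
2^G*2≤T : ∀ N → 2 ^ (16 ^ N + 16 ^ N) * 2 ≤ 2 ^ (2 ^ (4 * N + 2))
2^G*2≤T N = NP.≤-trans (NP.≤-reflexive (NP.*-comm (2 ^ (16 ^ N + 16 ^ N)) 2)) (NP.^-monoʳ-≤ 2
  (NP.≤-trans (2x+1≤4x (16 ^ N) (NP.m^n>0 16 N)) (NP.≤-reflexive 4·16^N≡2^[4N+2])))
  where
  2x+1≤4x : ∀ x → 1 ≤ x → suc (x + x) ≤ x + x + (x + x)
  2x+1≤4x x 1≤x = NP.≤-trans (NP.≤-reflexive (NP.+-comm 1 (x + x))) (NP.+-monoʳ-≤ (x + x) (NP.≤-trans 1≤x (NP.m≤m+n x x)))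
  times4 : ∀ x → x * 4 ≡ x + x + (x + x)
  times4 = solve-∀
  4·16^N≡2^[4N+2] : 16 ^ N + 16 ^ N + (16 ^ N + 16 ^ N) ≡ 2 ^ (4 * N + 2)
  4·16^N≡2^[4N+2] = sym (trans (NP.^-distribˡ-+-* 2 (4 * N) 2) (trans (cong (_* 4) (sym (NP.^-*-assoc 2 4 N))) (times4 (16 ^ N))))

clear-denominators : ∀ c n₂ T W β → 1 ≤ T → 1ℚ ℚ.≤ β →
  ι c ℚ.* β ℚ.* ι n₂ ℚ.≤ ι W ℚ.* invℕ T ℚ.+ ι W ℚ.* invℕ T → c * n₂ * T ≤ W + W
clear-denominators c n₂ T@(suc t) W β _ 1≤β bound = ι-cancel (begin
    ι (c * n₂ * T)
  ≡⟨ trans (ι-* (c * n₂) T) (cong (ℚ._* ι T) (ι-* c n₂)) ⟩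
    ι c ℚ.* ι n₂ ℚ.* ι T
  ≡⟨ sym (QP.*-identityʳ _) ⟩
    ι c ℚ.* ι n₂ ℚ.* ι T ℚ.* 1ℚ
  ≤⟨ QP.*-monoˡ-≤-nonNeg (ι c ℚ.* ι n₂ ℚ.* ι T) {{nonNeg (*-nonneg (*-nonneg (ι-nonneg c) (ι-nonneg n₂)) (ι-nonneg T))}} 1≤β ⟩
    ι c ℚ.* ι n₂ ℚ.* ι T ℚ.* β
  ≡⟨ rearrange (ι c) (ι n₂) (ι T) β ⟩
    ι c ℚ.* β ℚ.* ι n₂ ℚ.* ι T
  ≤⟨ QP.*-monoʳ-≤-nonNeg (ι T) {{nonNeg (ι-nonneg T)}} bound ⟩
    (ι W ℚ.* invℕ T ℚ.+ ι W ℚ.* invℕ T) ℚ.* ι T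
  ≡⟨ trans (QP.*-distribʳ-+ (ι T) (ι W ℚ.* invℕ T) (ι W ℚ.* invℕ T)) (cong₂ ℚ._+_ W/T*T W/T*T) ⟩
    ι W ℚ.+ ι W
  ≡⟨ sym (ι-+ W W) ⟩
    ι (W + W)
  ∎)
  where
  open QP.≤-Reasoning
  open +-*-Solver
  W/T*T : ι W ℚ.* invℕ T ℚ.* ι T ≡ ι W
  W/T*T = trans (QP.*-assoc (ι W) (invℕ T) (ι T)) (trans (cong (ι W ℚ.*_) (invℕ-inverse t)) (QP.*-identityʳ (ι W)))
  rearrange : ∀ a b c d → a ℚ.* b ℚ.* c ℚ.* d ≡ a ℚ.* d ℚ.* b ℚ.* c
  rearrange = solve 4 (λ a b c d → a :* b :* c :* d := a :* d :* b :* c) refl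

-- The theorem for fixed data, with c = 100 and y = β/(100 k²).  It suffices to find a natural
-- number G bounding every partial sum of exp y with count · |B|² · 2^G ≤ W = k² |B|^k φ(m)².
module Regimes (m : ℕ) (1≤m : 1 ≤ m) (sqf : Squarefree m) (B : Subset m) (B⊆units : ∀ x → x ∈ B → Coprime (toℕ x) m)
               (k' : ℕ) (β : ℚ) (β>0 : Positive β) where
  open Counting m B k' β using (k; n; U; count-bound; fewCount-bound)

  100k² : ℚ
  100k² = ι 100 ℚ.* ι (k * k)

  y : ℚ
  y = β ℚ.* recipℚ 100k²

  W : ℕ
  W = k * k * n ^ k * totient m ^ 2

  Witness : Set
  Witness = Σ ℕ λ G → (∀ j → expPartial y j ℚ.≤ ι G) × count m k B β * n ^ 2 * 2 ^ G ≤ W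

  100k²>0 : Positive 100k²
  100k²>0 = subst Positive (ι-* 100 (k * k)) (ι-pos (100 * (k * k)) (s≤s z≤n))

  y≥0 : 0ℚ ℚ.≤ y
  y≥0 = *-nonneg (QP.<⇒≤ (QP.positive⁻¹ β {{β>0}})) (recipℚ-nonneg 100k² 100k²>0)

  100y≤β : y ℚ.* ι 100 ℚ.≤ β
  100y≤β = begin
      y ℚ.* ι 100
    ≡⟨ sym (QP.*-identityʳ _) ⟩
      y ℚ.* ι 100 ℚ.* 1ℚ
    ≤⟨ QP.*-monoˡ-≤-nonNeg (y ℚ.* ι 100) {{nonNeg (*-nonneg y≥0 (ι-nonneg 100))}} (ι-mono {1} {k * k} (s≤s z≤n)) ⟩
      y ℚ.* ι 100 ℚ.* ι (k * k)
    ≡⟨ trans (QP.*-assoc y (ι 100) (ι (k * k))) (QP.*-assoc β (recipℚ 100k²) 100k²) ⟩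
      β ℚ.* (recipℚ 100k² ℚ.* 100k²)
    ≡⟨ trans (cong (β ℚ.*_) (recipℚ-inverse 100k² 100k²>0)) (QP.*-identityʳ β) ⟩
      β
    ∎
    where open QP.≤-Reasoning

  y≤ : ∀ {r} → β ℚ.≤ r ℚ.* ι 100 → y ℚ.≤ r
  y≤ β≤100r = QP.*-cancelʳ-≤-pos (ι 100) {{ι-pos 100 (s≤s z≤n)}} (QP.≤-trans 100y≤β β≤100r)

  -- β ≤ 50: then y ≤ 1/2, G = 2, and the trivial bound suffices
  small-β : β ℚ.≤ ι 50 → Witness
  small-β β≤50 = 2 , expPartial-small y y≥0 (y≤ (QP.≤-trans β≤50 (QP.≤-reflexive ½·100≡50))) ,
                 trivial-bound m B β β>0 k' (|B|≤φ B B⊆units)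
    where
    ½·100≡50 : ι 50 ≡ frac 1 1 ℚ.* ι 100
    ½·100≡50 = sym (trans (cong (frac 1 1 ℚ.*_) (ι-* 2 50))
      (trans (sym (QP.*-assoc (frac 1 1) (ι 2) (ι 50))) (trans (cong (ℚ._* ι 50) (invℕ-inverse 1)) (QP.*-identityˡ (ι 50)))))

  -- β > 50 with β ≤ 100N and 16N+12 ≤ β: then y ≤ N and G = 2·16^N; for T = 2^{2^{4N+2}}
  -- Mertens gives 2Q(T) ≤ 16N+12 ≤ β, so the Markov bound yields count · |B|² · T ≤ 2W
  large-β : ∀ N → β ℚ.≤ ι (100 * N) → ι (16 * N + 12) ℚ.≤ β → Witness
  large-β N β≤100N 16N+12≤β = 16 ^ N + 16 ^ N , expPartial-bounded y N y≥0 y≤N , count·2^G≤W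
    where
    y≤N : y ℚ.≤ ι N
    y≤N = y≤ (QP.≤-trans β≤100N (QP.≤-reflexive (trans (cong ι (NP.*-comm 100 N)) (ι-* N 100))))
    t = 4 * N + 2
    T = 2 ^ (2 ^ t)
    1≤T : 1 ≤ T
    1≤T = NP.m^n>0 2 (2 ^ t)
    2Q≤β : primeRecipSum T U ℚ.+ primeRecipSum T U ℚ.≤ β
    2Q≤β = begin
        primeRecipSum T U ℚ.+ primeRecipSum T U
      ≤⟨ QP.+-mono-≤ (primeRecipSum-bound t U (UniqueP.upTo⁺ (suc m))) (primeRecipSum-bound t U (UniqueP.upTo⁺ (suc m))) ⟩
        ι (2 + 2 * t) ℚ.+ ι (2 + 2 * t)
      ≡⟨ trans (sym (ι-+ (2 + 2 * t) (2 + 2 * t))) (cong ι (double N)) ⟩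
        ι (16 * N + 12)
      ≤⟨ 16N+12≤β ⟩
        β
      ∎
      where
      open QP.≤-Reasoning
      double : ∀ N → 2 + 2 * (4 * N + 2) + (2 + 2 * (4 * N + 2)) ≡ 16 * N + 12
      double = solve-∀
    1≤β : 1ℚ ℚ.≤ β
    1≤β = QP.≤-trans (ι-mono {1} {16 * N + 12} (NP.≤-trans (s≤s z≤n) (NP.m≤n+m 12 (16 * N)))) 16N+12≤β
    c = count m k B β
    count·T≤2W : c * n ^ 2 * T ≤ W + W
    count·T≤2W = clear-denominators c (n ^ 2) T W β 1≤T 1≤β
      (count-bound T W (n ^ 2) 1≤T (λ { p ((p-prime , p∣m) , _) → fewCount-bound 1≤m sqf B⊆units p p-prime p∣m }) 2Q≤β)
    count·2^G≤W : c * n ^ 2 * 2 ^ (16 ^ N + 16 ^ N) ≤ W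
    count·2^G≤W = NP.*-cancelʳ-≤ _ W 2 (begin
        c * n ^ 2 * 2 ^ (16 ^ N + 16 ^ N) * 2
      ≡⟨ NP.*-assoc (c * n ^ 2) _ 2 ⟩
        c * n ^ 2 * (2 ^ (16 ^ N + 16 ^ N) * 2)
      ≤⟨ NP.*-monoʳ-≤ (c * n ^ 2) (2^G*2≤T N) ⟩
        c * n ^ 2 * T
      ≤⟨ count·T≤2W ⟩
        W + W
      ≡⟨ trans (cong (W +_) (sym (NP.+-identityʳ W))) (NP.*-comm 2 W) ⟩
        W * 2
      ∎)
      where open NP.≤-Reasoning

  witness : Dec (β ℚ.≤ ι 50) → Witness
  witness (yes β≤50) = small-β β≤50
  witness (no β≰50) = let N , β≤100N , 16N+12≤β = choose-N β β>0 β≰50 in large-β N β≤100N 16N+12≤β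

  theorem : ∀ a b j → frac a b ℚ.≤ expPartial y j → (count m k B β * n ^ 2) ^ suc b * 2 ^ a ≤ W ^ suc b
  theorem a b j a/[b+1]≤E = conclude (witness (β QP.≤? ι 50))
    where
    conclude : Witness → (count m k B β * n ^ 2) ^ suc b * 2 ^ a ≤ W ^ suc b
    conclude (G , E≤G , count·2^G≤W) = exponent-bound (count m k B β * n ^ 2) W G a b a≤G[b+1] count·2^G≤W
      where
      a≤G[b+1] : a ≤ G * suc b
      a≤G[b+1] = subst (_≤ G * suc b) (NP.*-identityʳ a) (frac-≤⁻ a b G 0 (QP.≤-trans a/[b+1]≤E (E≤G j)))

lemma4p2 : ∃ λ (c : ℚ) → Positive c ×
    ((m : ℕ) → 1 ≤ m → Squarefree m →
     (B : Subset m) → (∀ x → x ∈ B → Coprime (toℕ x) m) →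
     (k : ℕ) → 1 ≤ k →
     (β : ℚ) → Positive β →
     (a b n : ℕ) →
     (ℤ.+ a ℚ./ suc b) ℚ.≤ expPartial (β ℚ.* recipℚ (c ℚ.* (ℤ.+ (k * k) ℚ./ 1))) n →
     (count m k B β * (∣ B ∣ ^ 2)) ^ suc b * 2 ^ a
       ≤ (k * k * ∣ B ∣ ^ k * totient m ^ 2) ^ suc b)
lemma4p2 = ι 100 , ι-pos 100 (s≤s z≤n) , λ where
  m 1≤m sqf B B⊆units (suc k') _ β β>0 a b j a/[b+1]≤E →
    subst (λ |B| → (count m (suc k') B β * |B| ^ 2) ^ suc b * 2 ^ a ≤ (suc k' * suc k' * |B| ^ suc k' * totient m ^ 2) ^ suc b)
          (length-elems B)
          (Regimes.theorem m 1≤m sqf B B⊆units k' β β>0 a b j a/[b+1]≤E)
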